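{- Let $X=\mathcal{M}_O(n,a,b)$ be feasible with $a>1$, and suppose $[v_0,v_a]\in\mathcal{G}$. Then $X$ admits an automorphism of order $2$ that maps $\mathcal{B}$ onto $\mathcal{R}$ and $\mathcal{R}$ onto $\mathcal{B}$ if and only if $8\mid n$, $a=4a_0+3<(n+4)/4$ with $a_0$ even, $4(a_0+1)^2\equiv 4\pmod n$, and $b=n/2+a-2$.
   Context: For even $n\ge4$ and odd $0<a<b<n$, $\mathcal{M}_O(n,a,b)$ has vertices $u_0,\dots,u_{n-1},v_0,\dots,v_{n-1}$ and edges $[u_i,u_{i+1}]$, $[u_i,v_i]$ for all $i$ and $[v_i,v_{i+a}]$, $[v_i,v_{i+b}]$ for even $i$ (subscripts mod $n$). It is feasible if $\gcd(b-a,n)=2$, $(b-a)^2/2\equiv 2\pmod n$, at least one of $a+(a-1)(a-b)/2\equiv1$ or $b+(b-1)(b-a)/2\equiv 1\pmod n$ holds, and $1\le a<b-2<n-a-2$. Let $x=a$ if $a+(a-1)(a-b)/2\equiv 1\pmod n$ and $x=b$ otherwise, and $y$ the other element of $\{a,b\}$. $\mathcal{R}=\{[u_i,v_i]\}$; $\mathcal{B}=\{[u_i,u_{i+1}]: i\text{ even}\}\cup\{[v_j,v_{j+x}]: j\text{ even}\}$; $\mathcal{G}=\{[u_i,u_{i+1}]: i\text{ odd}\}\cup\{[v_j,v_{j+y}]: j\text{ even}\}$. -}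

module Defs where

open import Data.Nat using (ℕ; zero; suc; _+_; _*_; _∸_; _^_; _≤_; _<_)
open import Data.Nat.DivMod using (_%_; _/_; m%n<n)
open import Data.Nat.Divisibility using (_∣_)
open import Data.Nat.GCD using (gcd)
open import Data.Integer as ℤ using (ℤ; +_; -_)
import Data.Integer.Divisibility as ℤD
open import Data.Fin using (Fin; toℕ; fromℕ<)
open import Data.Product using (Σ; _×_; ∃)
open import Data.Sum using (_⊎_)
open import Relation.Nullary using (¬_)
open import Relation.Binary.PropositionalEquality using (_≡_; _≢_)
open import Function.Bundles using (_⇔_)

_⊕_ : ∀ {n} → Fin n → ℕ → Fin n
_⊕_ {suc m} i k = fromℕ< (m%n<n (toℕ i + k) (suc m))

CongZ : ℕ → ℤ → ℤ → Set
CongZ n x y = (+ n) ℤD.∣ (x ℤ.- y)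

Even Odd : ℕ → Set
Even k = 2 ∣ k
Odd k = ¬ (2 ∣ k)

data V (n : ℕ) : Set where
  u v : Fin n → V n

-- edges of M_O(n,a,b) (directed generators; adjacency is the symmetric closure)
data Ed (n a b : ℕ) : V n → V n → Set where
  uu : (i : Fin n) → Ed n a b (u i) (u (i ⊕ 1))
  uv : (i : Fin n) → Ed n a b (u i) (v i)
  va : (i : Fin n) → Even (toℕ i) → Ed n a b (v i) (v (i ⊕ a))
  vb : (i : Fin n) → Even (toℕ i) → Ed n a b (v i) (v (i ⊕ b))

Adj : (n a b : ℕ) → V n → V n → Set
Adj n a b p q = Ed n a b p q ⊎ Ed n a b q p

-- a + (a-1)(a-b)/2 ≡ 1 (mod n)   (computed in ℤ; (a-b)/2 = -((b-a)/2) as a<b, b-a even)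
CondA : (n a b : ℕ) → Set
CondA n a b = CongZ n (+ a ℤ.+ (+ (a ∸ 1)) ℤ.* (- (+ ((b ∸ a) / 2)))) (+ 1)

CondB : (n a b : ℕ) → Set
CondB n a b = CongZ n (+ b ℤ.+ (+ (b ∸ 1)) ℤ.* (+ ((b ∸ a) / 2))) (+ 1)

Params : (n a b : ℕ) → Set
Params n a b = Even n × 4 ≤ n × Odd a × Odd b × 0 < a × a < b × b < n

Feasible : (n a b : ℕ) → Set
Feasible n a b =
  gcd (b ∸ a) n ≡ 2
  × CongZ n (+ (((b ∸ a) ^ 2) / 2)) (+ 2)
  × (CondA n a b ⊎ CondB n a b)
  × 1 ≤ a × a < b ∸ 2 × b ∸ 2 < n ∸ a ∸ 2

-- colour classes; x = a if CondA holds, x = b otherwise; y is the other one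
data Rd (n a b : ℕ) : V n → V n → Set where
  r : (i : Fin n) → Rd n a b (u i) (v i)

data Bd (n a b : ℕ) : V n → V n → Set where
  bu  : (i : Fin n) → Even (toℕ i) → Bd n a b (u i) (u (i ⊕ 1))
  bvA : (j : Fin n) → Even (toℕ j) → CondA n a b → Bd n a b (v j) (v (j ⊕ a))
  bvB : (j : Fin n) → Even (toℕ j) → ¬ CondA n a b → Bd n a b (v j) (v (j ⊕ b))

data Gd (n a b : ℕ) : V n → V n → Set where
  gu  : (i : Fin n) → Odd (toℕ i) → Gd n a b (u i) (u (i ⊕ 1))
  gvA : (j : Fin n) → Even (toℕ j) → CondA n a b → Gd n a b (v j) (v (j ⊕ b))
  gvB : (j : Fin n) → Even (toℕ j) → ¬ CondA n a b → Gd n a b (v j) (v (j ⊕ a))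

Rc Bc Gc : (n a b : ℕ) → V n → V n → Set
Rc n a b p q = Rd n a b p q ⊎ Rd n a b q p
Bc n a b p q = Bd n a b p q ⊎ Bd n a b q p
Gc n a b p q = Gd n a b p q ⊎ Gd n a b q p

IsAutomorphism : (n a b : ℕ) → (V n → V n) → Set
IsAutomorphism n a b σ =
  (∀ p q → σ p ≡ σ q → p ≡ q)
  × (∀ q → ∃ λ p → σ p ≡ q)
  × (∀ p q → Adj n a b p q ⇔ Adj n a b (σ p) (σ q))

HasOrder2 : ∀ {n} → (V n → V n) → Set
HasOrder2 {n} σ = (∀ p → σ (σ p) ≡ p) × Σ (V n) (λ p → σ p ≢ p)

MapsOnto : ∀ {n} → (V n → V n) → (V n → V n → Set) → (V n → V n → Set) → Set
MapsOnto {n} σ E F =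
  (∀ p q → E p q → F (σ p) (σ q))
  × (∀ p q → F p q → Σ (V n) λ p' → Σ (V n) λ q' → E p' q' × σ p' ≡ p × σ q' ≡ q)

V0VaInG : (n a b : ℕ) → Set
V0VaInG n a b = Σ (Fin n) λ i → toℕ i ≡ 0 × Gc n a b (v i) (v (i ⊕ a))

module Submission where

-- Each colour class is a perfect matching, hence the graph of an involution of the vertex set: red
-- exchanges u_i and v_i, while blue and green send a vertex of index i to index i + (−1)^i·c for an odd
-- step c depending on the layer (well defined because n is even).  An automorphism of order 2 exchanging
-- B and R is therefore the same as an involution σ with σ ∘ blue = red ∘ σ and σ ∘ green = green ∘ σ, and
-- composites of these maps act on indices as signed translations.
--
-- Necessity.  σ conjugates gb = green ∘ blue into gr = green ∘ red and br = blue ∘ red into rb = red ∘ blue.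
-- Starting from u₀, the walks gb^((a+1)/2) and gr², gb^((b−1)/2) and br², gb ∘ gr² and gr² ∘ gb end at the
-- same vertex; transported to σ u₀ these coincidences force a = 4k − 1, b = 4j + 1 and
-- k(a+1) ≡ 4, 2(b−a) + 4 ≡ 0, j(a+1) + b − 1 ≡ 0 (mod n).  The size constraints on a and b turn the second
-- congruence into n = 2(b−a) + 4, and the stated conditions follow by elementary arithmetic.
--
-- For n = 8h, a = 8a₁ + 3 and b = 4h + 8a₁ + 1, let σ send index 4K + ρ (0 ≤ ρ < 4) to
-- index (a+1)K + κ(ρ), exchanging layers according to ρ.  Each required identity then reduces to one
-- congruence per residue class, all following from (a+1)² ≡ 16 (mod 4n), that is 4(2a₁+1)² ≡ 4 (mod n).

open import Defs
open import Data.Nat.Base using (ℕ; zero; suc)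
open import Data.Nat.GeneralisedArithmetic using (fold)
import Data.Nat.Divisibility as ℕ
open import Data.Empty using (⊥-elim)
open import Relation.Binary.PropositionalEquality using (_≡_; _≢_; refl; sym; trans)

module ModularArithmetic where

  open import Data.Nat.Base as ℕ using (ℕ; zero; suc; _<_; _≤_; _∸_)
  import Data.Nat.Properties as ℕ
  open import Data.Integer.Base using (ℤ; +_; _+_; _-_; _*_; -_; 0ℤ; 1ℤ; -1ℤ; ∣_∣; _⊖_; _%ℕ_; _/ℕ_)
  import Data.Integer.Properties as ℤ
  open import Data.Integer.DivMod using (n%ℕd<d; a≡a%ℕn+[a/ℕn]*n)
  open import Data.Integer.Divisibility.Signed using (_∣_; divides; ∣⇒∣ᵤ; ∣ᵤ⇒∣; ∣-trans; ∣m∣n⇒∣m+n; ∣m⇒∣-m)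
  open import Data.Integer.Tactic.RingSolver using (solve-∀)
  open import Data.Fin.Base using (Fin; toℕ; fromℕ<)
  import Data.Fin.Properties as Fin
  open import Data.Product.Base using (Σ; _,_)
  open import Data.Sum.Base using (inj₁; inj₂)
  open import Data.Empty using (⊥)
  open import Function.Base using (_∘_)
  open import Relation.Nullary.Negation using (¬_; contradiction)
  open import Relation.Binary.PropositionalEquality

  infix 4 _≡_mod_

  -- A record rather than a definition, so that x, y and n stay inferable from a proof.
  record _≡_mod_ (x y : ℤ) (n : ℕ) : Set where
    constructor congruent
    field divides-difference : + n ∣ x - y

  module _ {n : ℕ} where

    ≡⇒mod : ∀ {x y} → x ≡ y → x ≡ y mod n
    ≡⇒mod {x} refl = congruent (divides 0ℤ (ℤ.+-inverseʳ x))

    mod-sym : ∀ {x y} → x ≡ y mod n → y ≡ x mod n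
    mod-sym {x} {y} (congruent x≡y) = congruent (subst (+ n ∣_) (ring x y) (∣m⇒∣-m x≡y))
      where ring : ∀ x y → - (x - y) ≡ y - x
            ring = solve-∀

    mod-trans : ∀ {x y z} → x ≡ y mod n → y ≡ z mod n → x ≡ z mod n
    mod-trans {x} {y} {z} (congruent x≡y) (congruent y≡z) = congruent
        (subst (+ n ∣_) (ring x y z) (∣m∣n⇒∣m+n x≡y y≡z))
      where ring : ∀ x y z → (x - y) + (y - z) ≡ x - z
            ring = solve-∀

    mod-+ : ∀ {x y x′ y′} → x ≡ y mod n → x′ ≡ y′ mod n → x + x′ ≡ y + y′ mod n
    mod-+ {x} {y} {x′} {y′} (congruent x≡y) (congruent x′≡y′) =
      congruent (subst (+ n ∣_) (ring x y x′ y′) (∣m∣n⇒∣m+n x≡y x′≡y′))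
      where ring : ∀ x y x′ y′ → (x - y) + (x′ - y′) ≡ (x + x′) - (y + y′)
            ring = solve-∀

  mod-scale : ∀ {n x y X Y} → x ≡ y mod n → ∀ c → X - Y ≡ c * (x - y) → X ≡ Y mod n
  mod-scale {n} (congruent (divides q x-y≡qn)) c X-Y≡c[x-y] =
    congruent (divides (c * q) (trans X-Y≡c[x-y] (trans (cong (c *_) x-y≡qn) (sym (ℤ.*-assoc c q (+ n))))))

  mod-combine : ∀ {n x y x′ y′ X Y} → x ≡ y mod n → x′ ≡ y′ mod n → ∀ c d →
                X - Y ≡ c * (x - y) + d * (x′ - y′) → X ≡ Y mod n
  mod-combine {n} (congruent (divides q x-y≡qn)) (congruent (divides q′ x′-y′≡q′n)) c d eq =
    congruent (divides (c * q + d * q′) (trans eq (trans (cong₂ (λ z z′ → c * z + d * z′) x-y≡qn x′-y′≡q′n) (ring c d q q′ (+ n)))))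
    where ring : ∀ c d q q′ n → c * (q * n) + d * (q′ * n) ≡ (c * q + d * q′) * n
          ring = solve-∀

  mod-weaken : ∀ {d n x y} → d ℕ.∣ n → x ≡ y mod n → x ≡ y mod d
  mod-weaken d∣n (congruent n∣x-y) = congruent (∣-trans (∣ᵤ⇒∣ d∣n) n∣x-y)

  multiple≡0 : ∀ {d} x → x * + d ≡ 0ℤ mod d
  multiple≡0 x = congruent (divides x (ℤ.+-identityʳ _))

  mod⇒CongZ : ∀ {n x y} → x ≡ y mod n → CongZ n x y
  mod⇒CongZ (congruent n∣x-y) = ∣⇒∣ᵤ n∣x-y

  CongZ⇒mod : ∀ {n x y} → CongZ n x y → x ≡ y mod n
  CongZ⇒mod n∣x-y = congruent (∣ᵤ⇒∣ n∣x-y)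

  ∣i⊖j∣<n : ∀ {n i j} → i < n → j < n → ∣ i ⊖ j ∣ < n
  ∣i⊖j∣<n {n} {i} {j} i<n j<n with ℕ.≤-total i j
  ... | inj₁ i≤j = subst (_< n) (sym (ℤ.∣⊖∣-≤ i≤j)) (ℕ.≤-<-trans (ℕ.m∸n≤m j i) j<n)
  ... | inj₂ j≤i = subst (_< n) (sym (trans (ℤ.∣m⊖n∣≡∣n⊖m∣ i j) (ℤ.∣⊖∣-≤ j≤i)))
                         (ℕ.≤-<-trans (ℕ.m∸n≤m i j) i<n)

  residue-unique : ∀ {n i j} → i < n → j < n → + i ≡ + j mod n → i ≡ j
  residue-unique {n} {i} {j} i<n j<n (congruent i≡j) = ℤ.+-injective (ℤ.i-j≡0⇒i≡j (+ i) (+ j) (ℤ.∣i∣≡0⇒i≡0 small))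
    where
    n∣d : n ℕ.∣ ∣ + i - + j ∣
    n∣d = ∣⇒∣ᵤ i≡j
    d<n : ∣ + i - + j ∣ < n
    d<n = subst (λ d → ∣ d ∣ < n) (sym (ℤ.m-n≡m⊖n i j)) (∣i⊖j∣<n i<n j<n)
    small : ∣ + i - + j ∣ ≡ 0
    small with ∣ + i - + j ∣ in eq
    ... | zero = refl
    ... | suc d = contradiction (ℕ.∣⇒≤ (subst (n ℕ.∣_) eq n∣d)) (ℕ.<⇒≱ (subst (_< n) eq d<n))

  0<c<n⇒c≢0 : ∀ {n c} → 0 < c → c < n → ¬ (+ c ≡ 0ℤ mod n)
  0<c<n⇒c≢0 {n} {c} 0<c c<n c≡0 = ℕ.<⇒≢ 0<c (sym (residue-unique c<n (ℕ.≤-<-trans ℕ.z≤n c<n) c≡0))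

  0<y-x<n⇒x≢y : ∀ {n x y d} → 0 < d → d < n → y - x ≡ + d → ¬ (x ≡ y mod n)
  0<y-x<n⇒x≢y {n} {x} {y} {d} 0<d d<n y-x≡d (congruent (divides q x-y≡qn)) =
    0<c<n⇒c≢0 0<d d<n (congruent (divides (- q) (begin
      + d - 0ℤ    ≡⟨ ℤ.+-identityʳ (+ d) ⟩
      + d         ≡⟨ sym y-x≡d ⟩
      y - x       ≡⟨ ring x y ⟩
      - (x - y)   ≡⟨ cong -_ x-y≡qn ⟩
      - (q * + n) ≡⟨ ℤ.neg-distribˡ-* q (+ n) ⟩
      - q * + n   ∎)))
    where
    open ≡-Reasoning
    ring : ∀ x y → y - x ≡ - (x - y)
    ring = solve-∀

  module Residues (n′ : ℕ) where

    reduce : ℤ → Fin (suc n′)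
    reduce z = fromℕ< (n%ℕd<d z (suc n′))

    toℕ-reduce : ∀ z → + toℕ (reduce z) ≡ z mod suc n′
    toℕ-reduce z = congruent (divides (- (z /ℕ suc n′)) (begin
      + toℕ (reduce z) - z                           ≡⟨ cong (λ r → + r - z) (Fin.toℕ-fromℕ< _) ⟩
      + (z %ℕ suc n′) - z                            ≡⟨ cong (λ w → + (z %ℕ suc n′) - w) (a≡a%ℕn+[a/ℕn]*n z (suc n′)) ⟩
      + (z %ℕ suc n′) - (+ (z %ℕ suc n′) + q * N)    ≡⟨ ring (+ (z %ℕ suc n′)) q N ⟩
      - q * N                                        ∎))
      where
      open ≡-Reasoning
      q = z /ℕ suc n′
      N = + suc n′
      ring : ∀ r q N → r - (r + q * N) ≡ - q * N
      ring = solve-∀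

    reduce-cong : ∀ {x y} → x ≡ y mod suc n′ → reduce x ≡ reduce y
    reduce-cong {x} {y} x≡y = Fin.toℕ-injective (residue-unique (Fin.toℕ<n _) (Fin.toℕ<n _)
      (mod-trans (toℕ-reduce x) (mod-trans x≡y (mod-sym (toℕ-reduce y)))))

    reduce-injective : ∀ {x y} → reduce x ≡ reduce y → x ≡ y mod suc n′
    reduce-injective {x} {y} eq =
      mod-trans (mod-sym (toℕ-reduce x)) (mod-trans (≡⇒mod (cong (λ i → + toℕ i) eq)) (toℕ-reduce y))

    reduce-toℕ : ∀ i → reduce (+ toℕ i) ≡ i
    reduce-toℕ i = Fin.toℕ-injective (residue-unique (Fin.toℕ<n _) (Fin.toℕ<n i) (toℕ-reduce (+ toℕ i)))

  pos-∸ : ∀ {m n} → n ≤ m → + (m ∸ n) ≡ + m - + n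
  pos-∸ {m} {n} n≤m = sym (trans (ℤ.m-n≡m⊖n m n) (ℤ.⊖-≥ n≤m))

  odd⇒suc-double : ∀ {k} → Odd k → Σ ℕ λ h → k ≡ suc (h ℕ.+ h)
  odd⇒suc-double {zero} k-odd = ⊥-elim (k-odd (ℕ.divides 0 refl))
  odd⇒suc-double {suc zero} _ = 0 , refl
  odd⇒suc-double {suc (suc k)} k-odd with odd⇒suc-double {k} (λ k-even → k-odd (ℕ.∣m∣n⇒∣m+n ℕ.∣-refl k-even))
  ... | h , refl = suc h , cong (suc ∘ suc) (sym (ℕ.+-suc h h))

  even⇒double : ∀ {k} → Even k → Σ ℕ λ h → k ≡ h ℕ.+ h
  even⇒double (ℕ.divides q k≡q*2) = q , trans k≡q*2 (trans (ℕ.*-comm q 2) (cong (q ℕ.+_) (ℕ.+-identityʳ q)))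

  data ParitySign (x π : ℤ) : Set where
    even : ∀ t → x ≡ t + t → π ≡ 1ℤ → ParitySign x π
    odd  : ∀ t → x ≡ t + t + 1ℤ → π ≡ -1ℤ → ParitySign x π

  Evenℤ Oddℤ : ℤ → Set
  Evenℤ x = ParitySign x 1ℤ
  Oddℤ x = ParitySign x -1ℤ

  0-even : Evenℤ 0ℤ
  0-even = even 0ℤ refl refl

  1-odd : Oddℤ 1ℤ
  1-odd = odd 0ℤ refl refl

  +1*≡+ : ∀ x y → x + 1ℤ * y ≡ x + y
  +1*≡+ = solve-∀

  +-1*≡- : ∀ x y → x + -1ℤ * y ≡ x - y
  +-1*≡- = solve-∀

  even≢odd : ∀ {x} t s → x ≡ t + t → x ≡ s + s + 1ℤ → ⊥
  even≢odd {x} t s x≡2t x≡2s+1 = ℕ.<⇒≱ (ℕ.s≤s (ℕ.s≤s ℕ.z≤n)) (ℕ.∣⇒≤ (∣⇒∣ᵤ (divides (t - s) 1≡2[t-s])))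
    where
    open ≡-Reasoning
    1≡2[t-s] : 1ℤ ≡ (t - s) * + 2
    1≡2[t-s] = begin
      1ℤ                   ≡⟨ ring₁ s ⟩
      s + s + 1ℤ - (s + s) ≡⟨ cong (λ y → y - (s + s)) (trans (sym x≡2s+1) x≡2t) ⟩
      t + t - (s + s)      ≡⟨ ring₂ t s ⟩
      (t - s) * + 2        ∎
      where
      ring₁ : ∀ s → 1ℤ ≡ s + s + 1ℤ - (s + s)
      ring₁ = solve-∀
      ring₂ : ∀ t s → t + t - (s + s) ≡ (t - s) * + 2
      ring₂ = solve-∀

  paritySign-unique : ∀ {x π ρ} → ParitySign x π → ParitySign x ρ → π ≡ ρ
  paritySign-unique (even _ _ refl) (even _ _ refl) = refl
  paritySign-unique (odd _ _ refl) (odd _ _ refl) = refl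
  paritySign-unique (even t x≡2t _) (odd s x≡2s+1 _) = ⊥-elim (even≢odd t s x≡2t x≡2s+1)
  paritySign-unique (odd t x≡2t+1 _) (even s x≡2s _) = ⊥-elim (even≢odd s t x≡2s x≡2t+1)

  paritySign-step : ∀ {x c π ρ} → ParitySign x π → ParitySign c ρ → ParitySign (x + π * c) (π * ρ)
  paritySign-step (even t refl refl) (even s refl refl) = even (t + s) (ring t s) refl
    where ring : ∀ t s → t + t + 1ℤ * (s + s) ≡ t + s + (t + s)
          ring = solve-∀
  paritySign-step (even t refl refl) (odd s refl refl) = odd (t + s) (ring t s) refl
    where ring : ∀ t s → t + t + 1ℤ * (s + s + 1ℤ) ≡ t + s + (t + s) + 1ℤ
          ring = solve-∀
  paritySign-step (odd t refl refl) (even s refl refl) = odd (t - s) (ring t s) refl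
    where ring : ∀ t s → t + t + 1ℤ + -1ℤ * (s + s) ≡ t - s + (t - s) + 1ℤ
          ring = solve-∀
  paritySign-step (odd t refl refl) (odd s refl refl) = even (t - s) (ring t s) refl
    where ring : ∀ t s → t + t + 1ℤ + -1ℤ * (s + s + 1ℤ) ≡ t - s + (t - s)
          ring = solve-∀

  paritySign-square : ∀ {x π} → ParitySign x π → π * π ≡ 1ℤ
  paritySign-square (even _ _ refl) = refl
  paritySign-square (odd _ _ refl) = refl

  paritySign-+double : ∀ {y π} → ParitySign y π → ∀ e → ParitySign (y + (e + e)) π
  paritySign-+double (even t refl π≡) e = even (t + e) (ring t e) π≡
    where ring : ∀ t e → t + t + (e + e) ≡ t + e + (t + e)
          ring = solve-∀
  paritySign-+double (odd t refl π≡) e = odd (t + e) (ring t e) π≡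
    where ring : ∀ t e → t + t + 1ℤ + (e + e) ≡ t + e + (t + e) + 1ℤ
          ring = solve-∀

  paritySign-mod : ∀ {n x y π} → Evenℤ (+ n) → x ≡ y mod n → ParitySign y π → ParitySign x π
  paritySign-mod {n} {x} {y} (even h n≡2h _) (congruent (divides q x-y≡qn)) y∶π =
    subst (λ z → ParitySign z _) (sym x≡y+2qh) (paritySign-+double y∶π (q * h))
    where
    open ≡-Reasoning
    x≡y+2qh : x ≡ y + (q * h + q * h)
    x≡y+2qh = begin
      x                 ≡⟨ ring₁ x y ⟩
      (x - y) + y       ≡⟨ cong (_+ y) x-y≡qn ⟩
      q * + n + y       ≡⟨ cong (λ N → q * N + y) n≡2h ⟩
      q * (h + h) + y   ≡⟨ ring₂ q h y ⟩
      y + (q * h + q * h) ∎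
      where
      ring₁ : ∀ x y → x ≡ (x - y) + y
      ring₁ = solve-∀
      ring₂ : ∀ q h y → q * (h + h) + y ≡ y + (q * h + q * h)
      ring₂ = solve-∀

  sign : ℕ → ℤ
  sign zero = 1ℤ
  sign (suc zero) = -1ℤ
  sign (suc (suc k)) = sign k

  paritySign-sign : ∀ k → ParitySign (+ k) (sign k)
  paritySign-sign zero = even 0ℤ refl refl
  paritySign-sign (suc zero) = odd 0ℤ refl refl
  paritySign-sign (suc (suc k)) = subst (λ z → ParitySign z (sign k)) (ℤ.+-comm (+ k) (+ 2))
    (paritySign-+double (paritySign-sign k) 1ℤ)

  Evenℤ⇒Even : ∀ {k} → Evenℤ (+ k) → Even k
  Evenℤ⇒Even (even t k≡2t _) = ∣⇒∣ᵤ (divides t (trans k≡2t (ring t)))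
    where ring : ∀ t → t + t ≡ t * + 2
          ring = solve-∀
  Evenℤ⇒Even (odd _ _ ())

  Even⇒Evenℤ : ∀ {k} → Even k → Evenℤ (+ k)
  Even⇒Evenℤ {k} (ℕ.divides q k≡2q) = even (+ q) (trans (cong +_ k≡2q) (trans (ℤ.pos-* q 2) (ring (+ q)))) refl
    where ring : ∀ t → t * + 2 ≡ t + t
          ring = solve-∀

  Odd⇒Oddℤ : ∀ {k} → Odd k → Oddℤ (+ k)
  Odd⇒Oddℤ {k} k-odd with paritySign-sign k
  ... | even t eq π≡ = ⊥-elim (k-odd (Evenℤ⇒Even (even t eq refl)))
  ... | odd t eq _ = odd t eq refl

  Oddℤ⇒Odd : ∀ {k} → Oddℤ (+ k) → Odd k
  Oddℤ⇒Odd k-odd k-even with paritySign-unique k-odd (Even⇒Evenℤ k-even)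
  ... | ()

  sign-even : ∀ {k} → Even k → sign k ≡ 1ℤ
  sign-even k-even = paritySign-unique (paritySign-sign _) (Even⇒Evenℤ k-even)

  sign-odd : ∀ {k} → Odd k → sign k ≡ -1ℤ
  sign-odd k-odd = paritySign-unique (paritySign-sign _) (Odd⇒Oddℤ k-odd)

  Evenℤ-*ˡ : ∀ c {x} → Evenℤ x → Evenℤ (c * x)
  Evenℤ-*ˡ c (even t refl refl) = even (c * t) (ring c t) refl
    where ring : ∀ c t → c * (t + t) ≡ c * t + c * t
          ring = solve-∀
  Evenℤ-*ˡ c (odd _ _ ())

  fold-intertwine : ∀ {A : Set} {σ f g : A → A} → (∀ p → σ (f p) ≡ g (σ p)) →
                    ∀ k p → σ (fold p f k) ≡ fold (σ p) g k
  fold-intertwine σf≡gσ zero p = refl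
  fold-intertwine {g = g} σf≡gσ (suc k) p = trans (σf≡gσ _) (cong g (fold-intertwine σf≡gσ k p))

  fold-double : ∀ {A : Set} (f : A → A) k p → fold p f (k ℕ.+ k) ≡ fold p (f ∘ f) k
  fold-double f zero p = refl
  fold-double f (suc k) p = begin
    fold p f (suc k ℕ.+ suc k)     ≡⟨ cong (λ j → fold p f (suc j)) (ℕ.+-suc k k) ⟩
    f (f (fold p f (k ℕ.+ k)))     ≡⟨ cong (f ∘ f) (fold-double f k p) ⟩
    f (f (fold p (f ∘ f) k))       ∎
    where open ≡-Reasoning

module Arithmetic where

  open ModularArithmetic
  open import Data.Nat.Base as ℕ using (ℕ; zero; suc; _<_; _≤_; _∸_; z≤n; s≤s)
  import Data.Nat.Properties as ℕ
  open import Data.Nat.DivMod using (_/_; m*n/n≡m)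
  import Data.Nat.Tactic.RingSolver as ℕ-Ring
  open import Data.Integer.Base using (ℤ; +_; _+_; _-_; _*_; 0ℤ; 1ℤ; -1ℤ)
  import Data.Integer.Properties as ℤ
  open import Data.Integer.Divisibility.Signed using (_∣_; divides; ∣⇒∣ᵤ)
  open import Data.Integer.Tactic.RingSolver using (solve-∀)
  open import Data.Product.Base using (Σ; _×_; _,_)
  open import Relation.Nullary.Negation using (contradiction)
  open import Relation.Binary.PropositionalEquality hiding (J)

  record SwapCongruences (n a b : ℕ) : Set where
    field
      k j : ℕ
      a+1≡4k : a ℕ.+ 1 ≡ 4 ℕ.* k
      b≡4j+1 : b ≡ 4 ℕ.* j ℕ.+ 1
      k[a+1]≡4 : + k * (+ a + 1ℤ) ≡ + 4 mod n
      2[b-a]+4≡0 : + 2 * (+ b - + a) + + 4 ≡ 0ℤ mod n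
      j[a+1]+b-1≡0 : + j * (+ a + 1ℤ) + + b - 1ℤ ≡ 0ℤ mod n

  Conditions : ℕ → ℕ → ℕ → Set
  Conditions n a b =
    8 ℕ.∣ n × (Σ ℕ λ a₀ → a ≡ 4 ℕ.* a₀ ℕ.+ 3 × Even a₀ × CongZ n (+ (4 ℕ.* (a₀ ℕ.+ 1) ℕ.^ 2)) (+ 4))
    × 4 ℕ.* a < n ℕ.+ 4 × b ≡ n / 2 ℕ.+ a ∸ 2

  multiple-below-double : ∀ {n m} → n ℕ.∣ m → 0 < m → m < 2 ℕ.* n → m ≡ n
  multiple-below-double (ℕ.divides zero refl) () _
  multiple-below-double {n} (ℕ.divides (suc zero) refl) _ _ = ℕ.+-identityʳ n
  multiple-below-double {n} (ℕ.divides (suc (suc q)) refl) _ m<2n =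
    contradiction (ℕ.*-monoˡ-≤ n (s≤s (s≤s (z≤n {q})))) (ℕ.<⇒≱ m<2n)

  module _ {n a b : ℕ} (1<a : 1 < a) (a<b : a < b) (a+b<n : a ℕ.+ b < n) (congs : SwapCongruences n a b) where
    open SwapCongruences congs

    K J : ℤ
    K = + k
    J = + j

    A≡4K-1 : + a ≡ + 4 * K - 1ℤ
    A≡4K-1 = begin
      + a                ≡⟨ ring (+ a) ⟩
      + a + 1ℤ - 1ℤ      ≡⟨ cong (_- 1ℤ) (trans (sym (ℤ.pos-+ a 1)) (trans (cong +_ a+1≡4k) (ℤ.pos-* 4 k))) ⟩
      + 4 * K - 1ℤ       ∎
      where open ≡-Reasoning
            ring : ∀ x → x ≡ x + 1ℤ - 1ℤ
            ring = solve-∀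

    B≡4J+1 : + b ≡ + 4 * J + 1ℤ
    B≡4J+1 = trans (cong +_ b≡4j+1) (trans (ℤ.pos-+ (4 ℕ.* j) 1) (cong (_+ 1ℤ) (ℤ.pos-* 4 j)))

    D : ℕ
    D = 2 ℕ.* (b ∸ a) ℕ.+ 4

    D≡2[b-a]+4 : + D ≡ + 2 * (+ b - + a) + + 4
    D≡2[b-a]+4 = trans (ℤ.pos-+ (2 ℕ.* (b ∸ a)) 4)
                       (cong (_+ + 4) (trans (ℤ.pos-* 2 (b ∸ a)) (cong (+ 2 *_) (pos-∸ (ℕ.<⇒≤ a<b)))))

    n≡D : n ≡ D
    n≡D = sym (multiple-below-double n∣D (subst (0 <_) (ℕ.+-comm 4 _) (s≤s z≤n)) D<2n)
      where
      n∣D : n ℕ.∣ D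
      n∣D = ∣⇒∣ᵤ (subst (+ n ∣_) (trans (ℤ.+-identityʳ _) (sym D≡2[b-a]+4)) (_≡_mod_.divides-difference 2[b-a]+4≡0))
      D<2n : D < 2 ℕ.* n
      D<2n = subst (_< 2 ℕ.* n) (ℕ-ring (b ∸ a)) (ℕ.*-monoʳ-< 2 (ℕ.≤-<-trans (ℕ.+-mono-≤ (ℕ.m∸n≤m b a) 1<a) a+b<n′))
        where
        a+b<n′ : b ℕ.+ a < n
        a+b<n′ = subst (_< n) (ℕ.+-comm a b) a+b<n
        ℕ-ring : ∀ d → 2 ℕ.* (d ℕ.+ 2) ≡ 2 ℕ.* d ℕ.+ 4
        ℕ-ring = ℕ-Ring.solve-∀

    n+2a≡2b+4 : n ℕ.+ 2 ℕ.* a ≡ 2 ℕ.* b ℕ.+ 4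
    n+2a≡2b+4 = begin
      n ℕ.+ 2 ℕ.* a                     ≡⟨ cong (ℕ._+ 2 ℕ.* a) n≡D ⟩
      2 ℕ.* (b ∸ a) ℕ.+ 4 ℕ.+ 2 ℕ.* a   ≡⟨ ℕ-ring (b ∸ a) a ⟩
      2 ℕ.* (b ∸ a ℕ.+ a) ℕ.+ 4         ≡⟨ cong (λ x → 2 ℕ.* x ℕ.+ 4) (ℕ.m∸n+n≡m (ℕ.<⇒≤ a<b)) ⟩
      2 ℕ.* b ℕ.+ 4                     ∎
      where
      open ≡-Reasoning
      ℕ-ring : ∀ d a → 2 ℕ.* d ℕ.+ 4 ℕ.+ 2 ℕ.* a ≡ 2 ℕ.* (d ℕ.+ a) ℕ.+ 4
      ℕ-ring = ℕ-Ring.solve-∀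

    n≡8[J-K+1] : + n ≡ + 8 * (J - K + 1ℤ)
    n≡8[J-K+1] = begin
      + n                                         ≡⟨ cong +_ n≡D ⟩
      + D                                         ≡⟨ D≡2[b-a]+4 ⟩
      + 2 * (+ b - + a) + + 4                     ≡⟨ cong₂ (λ x y → + 2 * (y - x) + + 4) A≡4K-1 B≡4J+1 ⟩
      + 2 * ((+ 4 * J + 1ℤ) - (+ 4 * K - 1ℤ)) + + 4 ≡⟨ ring J K ⟩
      + 8 * (J - K + 1ℤ)                          ∎
      where
      open ≡-Reasoning
      ring : ∀ J K → + 2 * ((+ 4 * J + 1ℤ) - (+ 4 * K - 1ℤ)) + + 4 ≡ + 8 * (J - K + 1ℤ)
      ring = solve-∀

    8∣n : 8 ℕ.∣ n
    8∣n = ∣⇒∣ᵤ (divides (J - K + 1ℤ) (trans n≡8[J-K+1] (ℤ.*-comm (+ 8) _)))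

    t : ℕ
    t = ℕ._∣_.quotient 8∣n

    T : ℤ
    T = + t

    n≡t*8 : n ≡ t ℕ.* 8
    n≡t*8 = ℕ._∣_.equality 8∣n

    J≡T+K-1 : J ≡ T + K - 1ℤ
    J≡T+K-1 = trans (ring J K) (cong (λ x → x + K - 1ℤ) J-K+1≡T)
      where
      J-K+1≡T : J - K + 1ℤ ≡ T
      J-K+1≡T = ℤ.*-cancelˡ-≡ (+ 8) _ _
          (trans (sym n≡8[J-K+1]) (trans (cong +_ n≡t*8) (trans (ℤ.pos-* t 8) (ℤ.*-comm T (+ 8)))))
      ring : ∀ J K → J ≡ J - K + 1ℤ + K - 1ℤ
      ring = solve-∀

    a₀ : ℕ
    a₀ = k ∸ 1

    k≡1+a₀ : k ≡ 1 ℕ.+ a₀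
    k≡1+a₀ = positive a+1≡4k
      where
      positive : ∀ {a k} → a ℕ.+ 1 ≡ 4 ℕ.* k → k ≡ 1 ℕ.+ (k ∸ 1)
      positive {a} {zero} eq = contradiction (trans (ℕ.+-comm 1 a) eq) λ ()
      positive {k = suc k} _ = refl

    a≡4a₀+3 : a ≡ 4 ℕ.* a₀ ℕ.+ 3
    a≡4a₀+3 = ℕ.+-cancelʳ-≡ 1 a (4 ℕ.* a₀ ℕ.+ 3)
                (trans a+1≡4k (trans (cong (4 ℕ.*_) k≡1+a₀) (ℕ-ring a₀)))
      where ℕ-ring : ∀ x → 4 ℕ.* (1 ℕ.+ x) ≡ 4 ℕ.* x ℕ.+ 3 ℕ.+ 1
            ℕ-ring = ℕ-Ring.solve-∀

    4[a₀+1]²≡4 : CongZ n (+ (4 ℕ.* (a₀ ℕ.+ 1) ℕ.^ 2)) (+ 4)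
    4[a₀+1]²≡4 = mod⇒CongZ (subst (λ x → x ≡ + 4 mod n) (sym square) k[a+1]≡4)
      where
      square : + (4 ℕ.* (a₀ ℕ.+ 1) ℕ.^ 2) ≡ K * (+ a + 1ℤ)
      square = begin
        + (4 ℕ.* (a₀ ℕ.+ 1) ℕ.^ 2)           ≡⟨ cong +_ (ℕ-ring a₀) ⟩
        + ((1 ℕ.+ a₀) ℕ.* (4 ℕ.* (1 ℕ.+ a₀))) ≡⟨ cong (λ x → + (x ℕ.* (4 ℕ.* x))) (sym k≡1+a₀) ⟩
        + (k ℕ.* (4 ℕ.* k))                  ≡⟨ cong (λ x → + (k ℕ.* x)) (sym a+1≡4k) ⟩
        + (k ℕ.* (a ℕ.+ 1))                  ≡⟨ ℤ.pos-* k (a ℕ.+ 1) ⟩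
        K * + (a ℕ.+ 1)                      ≡⟨ cong (K *_) (ℤ.pos-+ a 1) ⟩
        K * (+ a + 1ℤ)                       ∎
        where
        open ≡-Reasoning
        ℕ-ring : ∀ x → 4 ℕ.* ((x ℕ.+ 1) ℕ.* ((x ℕ.+ 1) ℕ.* 1)) ≡ (1 ℕ.+ x) ℕ.* (4 ℕ.* (1 ℕ.+ x))
        ℕ-ring = ℕ-Ring.solve-∀

    -- (j(a+1) + b − 1) − (k(a+1) − 4) = 4t(k+1) is a multiple of n = 8t, so k + 1 = a₀ + 2 is even.
    a₀-even : Even a₀
    a₀-even = ℕ.∣m+n∣m⇒∣n (subst (2 ℕ.∣_) (ℕ.+-comm a₀ 2) 2∣a₀+2) ℕ.∣-refl
      where
      combination : ∀ {A B J K T} → A ≡ + 4 * K - 1ℤ → B ≡ + 4 * J + 1ℤ → J ≡ T + K - 1ℤ →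
                    + 4 * T * (K + 1ℤ) - 0ℤ ≡ 1ℤ * (J * (A + 1ℤ) + B - 1ℤ - 0ℤ) + -1ℤ * (K * (A + 1ℤ) - + 4)
      combination {K = k′} {T = t′} refl refl refl = ring k′ t′
        where ring : ∀ K T → + 4 * T * (K + 1ℤ) - 0ℤ
                             ≡ 1ℤ * ((T + K - 1ℤ) * (+ 4 * K - 1ℤ + 1ℤ) + (+ 4 * (T + K - 1ℤ) + 1ℤ) - 1ℤ - 0ℤ)
                               + -1ℤ * (K * (+ 4 * K - 1ℤ + 1ℤ) - + 4)
              ring = solve-∀
      4T[K+1]≡0 : + 4 * T * (K + 1ℤ) ≡ 0ℤ mod n
      4T[K+1]≡0 = mod-combine j[a+1]+b-1≡0 k[a+1]≡4 1ℤ -1ℤ (combination {+ a} {+ b} {J} {K} {T} A≡4K-1 B≡4J+1 J≡T+K-1)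
      t≢0 : t ≢ 0
      t≢0 t≡0 = ℕ.<⇒≢ (ℕ.≤-<-trans z≤n a+b<n) (sym (trans n≡t*8 (cong (ℕ._* 8) t≡0)))
      n∣4t[k+1] : n ℕ.∣ 4 ℕ.* t ℕ.* (k ℕ.+ 1)
      n∣4t[k+1] = ∣⇒∣ᵤ (subst (+ n ∣_) (trans (ℤ.+-identityʳ _) (sym pos-eq)) (_≡_mod_.divides-difference 4T[K+1]≡0))
        where
        pos-eq : + (4 ℕ.* t ℕ.* (k ℕ.+ 1)) ≡ + 4 * T * (K + 1ℤ)
        pos-eq = trans (ℤ.pos-* (4 ℕ.* t) (k ℕ.+ 1)) (cong₂ _*_ (ℤ.pos-* 4 t) (ℤ.pos-+ k 1))
      halve : ∀ t {x} → t ≢ 0 → t ℕ.* 8 ℕ.∣ 4 ℕ.* t ℕ.* x → 2 ℕ.∣ x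
      halve zero t≢0 _ = contradiction refl t≢0
      halve (suc t) {x} _ 8t∣4tx = ℕ.*-cancelˡ-∣ (4 ℕ.* suc t) (subst (ℕ._∣ 4 ℕ.* suc t ℕ.* x) (ℕ-ring t) 8t∣4tx)
        where ℕ-ring : ∀ t → suc t ℕ.* 8 ≡ 4 ℕ.* suc t ℕ.* 2
              ℕ-ring = ℕ-Ring.solve-∀
      2∣a₀+2 : 2 ℕ.∣ a₀ ℕ.+ 2
      2∣a₀+2 = subst (2 ℕ.∣_) (trans (cong (ℕ._+ 1) k≡1+a₀) (trans (ℕ.+-comm (1 ℕ.+ a₀) 1) (ℕ.+-comm 2 a₀)))
                     (halve t t≢0 (subst (ℕ._∣ _) n≡t*8 n∣4t[k+1]))

    4a<n+4 : 4 ℕ.* a < n ℕ.+ 4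
    4a<n+4 = ℕ.+-cancelʳ-≤ n (suc (4 ℕ.* a)) (n ℕ.+ 4) (begin
      suc (4 ℕ.* a) ℕ.+ n                  ≡⟨ cong suc 4a+n≡2[a+b]+4 ⟩
      suc (2 ℕ.* (a ℕ.+ b) ℕ.+ 4)          ≤⟨ ℕ.+-monoˡ-≤ 4 (ℕ.*-monoʳ-< 2 a+b<n) ⟩
      2 ℕ.* n ℕ.+ 4                        ≡⟨ ℕ-ring n ⟩
      n ℕ.+ 4 ℕ.+ n                        ∎)
      where
      open ℕ.≤-Reasoning
      4a+n≡2[a+b]+4 : 4 ℕ.* a ℕ.+ n ≡ 2 ℕ.* (a ℕ.+ b) ℕ.+ 4
      4a+n≡2[a+b]+4 = begin-equality
        4 ℕ.* a ℕ.+ n                      ≡⟨ ℕ-ring₁ a n ⟩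
        2 ℕ.* a ℕ.+ (n ℕ.+ 2 ℕ.* a)        ≡⟨ cong (2 ℕ.* a ℕ.+_) n+2a≡2b+4 ⟩
        2 ℕ.* a ℕ.+ (2 ℕ.* b ℕ.+ 4)        ≡⟨ ℕ-ring₂ a b ⟩
        2 ℕ.* (a ℕ.+ b) ℕ.+ 4              ∎
        where
        ℕ-ring₁ : ∀ a n → 4 ℕ.* a ℕ.+ n ≡ 2 ℕ.* a ℕ.+ (n ℕ.+ 2 ℕ.* a)
        ℕ-ring₁ = ℕ-Ring.solve-∀
        ℕ-ring₂ : ∀ a b → 2 ℕ.* a ℕ.+ (2 ℕ.* b ℕ.+ 4) ≡ 2 ℕ.* (a ℕ.+ b) ℕ.+ 4
        ℕ-ring₂ = ℕ-Ring.solve-∀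
      ℕ-ring : ∀ n → 2 ℕ.* n ℕ.+ 4 ≡ n ℕ.+ 4 ℕ.+ n
      ℕ-ring = ℕ-Ring.solve-∀

    b≡n/2+a-2 : b ≡ n / 2 ℕ.+ a ∸ 2
    b≡n/2+a-2 = sym (begin
      n / 2 ℕ.+ a ∸ 2         ≡⟨ cong (λ h → h ℕ.+ a ∸ 2) n/2≡4t ⟩
      4 ℕ.* t ℕ.+ a ∸ 2       ≡⟨ cong (_∸ 2) 4t+a≡b+2 ⟩
      b ℕ.+ 2 ∸ 2             ≡⟨ ℕ.m+n∸n≡m b 2 ⟩
      b                       ∎)
      where
      open ≡-Reasoning
      n≡4t*2 : n ≡ 4 ℕ.* t ℕ.* 2
      n≡4t*2 = trans n≡t*8 (ℕ-ring t)
        where ℕ-ring : ∀ t → t ℕ.* 8 ≡ 4 ℕ.* t ℕ.* 2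
              ℕ-ring = ℕ-Ring.solve-∀
      n/2≡4t : n / 2 ≡ 4 ℕ.* t
      n/2≡4t = trans (cong (_/ 2) n≡4t*2) (m*n/n≡m (4 ℕ.* t) 2)
      4t+a≡b+2 : 4 ℕ.* t ℕ.+ a ≡ b ℕ.+ 2
      4t+a≡b+2 = ℕ.*-cancelˡ-≡ _ _ 2 (begin
        2 ℕ.* (4 ℕ.* t ℕ.+ a)   ≡⟨ ℕ-ring₁ t a ⟩
        4 ℕ.* t ℕ.* 2 ℕ.+ 2 ℕ.* a ≡⟨ cong (ℕ._+ 2 ℕ.* a) (sym n≡4t*2) ⟩
        n ℕ.+ 2 ℕ.* a           ≡⟨ n+2a≡2b+4 ⟩
        2 ℕ.* b ℕ.+ 4           ≡⟨ ℕ-ring₂ b ⟩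
        2 ℕ.* (b ℕ.+ 2)         ∎)
        where
        ℕ-ring₁ : ∀ t a → 2 ℕ.* (4 ℕ.* t ℕ.+ a) ≡ 4 ℕ.* t ℕ.* 2 ℕ.+ 2 ℕ.* a
        ℕ-ring₁ = ℕ-Ring.solve-∀
        ℕ-ring₂ : ∀ b → 2 ℕ.* b ℕ.+ 4 ≡ 2 ℕ.* (b ℕ.+ 2)
        ℕ-ring₂ = ℕ-Ring.solve-∀

    congruences⇒conditions : Conditions n a b
    congruences⇒conditions = 8∣n , (a₀ , a≡4a₀+3 , a₀-even , 4[a₀+1]²≡4) , 4a<n+4 , b≡n/2+a-2

  b-2<n-a-2⇒a+b<n : ∀ {n a b} → a ≤ n → b ∸ 2 < n ∸ a ∸ 2 → a ℕ.+ b < n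
  b-2<n-a-2⇒a+b<n {n} {a} {b} a≤n b-2<n-a-2 =
    subst (_< n) (ℕ.+-comm b a) (subst (b ℕ.+ a <_) (ℕ.m∸n+n≡m a≤n) (ℕ.+-monoˡ-< a b<n∸a))
    where
    b<n∸a : b < n ∸ a
    b<n∸a = ℕ.≰⇒> (λ n∸a≤b → ℕ.<⇒≱ b-2<n-a-2 (ℕ.∸-monoˡ-≤ 2 n∸a≤b))

  record ConstructionData (n a b : ℕ) : Set where
    field
      H A₁ : ℤ
      n≡8H : + n ≡ + 8 * H
      a≡8A₁+3 : + a ≡ + 8 * A₁ + + 3
      b≡4H+8A₁+1 : + b ≡ + 4 * H + + 8 * A₁ + + 1
      square : + 4 * (A₁ + A₁ + 1ℤ) * (A₁ + A₁ + 1ℤ) ≡ + 4 mod n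

  conditions⇒data : ∀ {n a b} → Conditions n a b → ConstructionData n a b
  conditions⇒data {n} {a} {b} (ℕ.divides h n≡h*8 , (a₀ , a≡4a₀+3 , ℕ.divides a₁ a₀≡a₁*2 , square) , _ , b≡n/2+a-2) = record
    { H = + h ; A₁ = + a₁
    ; n≡8H = trans (cong +_ (trans n≡h*8 (ℕ.*-comm h 8))) (ℤ.pos-* 8 h)
    ; a≡8A₁+3 = trans (cong +_ a≡8a₁+3) (trans (ℤ.pos-+ (8 ℕ.* a₁) 3) (cong (_+ + 3) (ℤ.pos-* 8 a₁)))
    ; b≡4H+8A₁+1 = trans (cong +_ b≡4h+8a₁+1)
                     (trans (ℤ.pos-+ (4 ℕ.* h ℕ.+ 8 ℕ.* a₁) 1)
                       (cong (_+ + 1) (trans (ℤ.pos-+ (4 ℕ.* h) (8 ℕ.* a₁)) (cong₂ _+_ (ℤ.pos-* 4 h) (ℤ.pos-* 8 a₁)))))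
    ; square = subst (λ x → x ≡ + 4 mod n) square≡ (CongZ⇒mod square)
    }
    where
    open ≡-Reasoning
    a≡8a₁+3 : a ≡ 8 ℕ.* a₁ ℕ.+ 3
    a≡8a₁+3 = trans a≡4a₀+3 (trans (cong (λ x → 4 ℕ.* x ℕ.+ 3) a₀≡a₁*2) (ℕ-ring a₁))
      where ℕ-ring : ∀ x → 4 ℕ.* (x ℕ.* 2) ℕ.+ 3 ≡ 8 ℕ.* x ℕ.+ 3
            ℕ-ring = ℕ-Ring.solve-∀
    b≡4h+8a₁+1 : b ≡ 4 ℕ.* h ℕ.+ 8 ℕ.* a₁ ℕ.+ 1
    b≡4h+8a₁+1 = begin
      b                                  ≡⟨ b≡n/2+a-2 ⟩
      n / 2 ℕ.+ a ∸ 2                    ≡⟨ cong₂ (λ m x → m ℕ.+ x ∸ 2) n/2≡4h a≡8a₁+3 ⟩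
      4 ℕ.* h ℕ.+ (8 ℕ.* a₁ ℕ.+ 3) ∸ 2    ≡⟨ cong (_∸ 2) (ℕ-ring h a₁) ⟩
      4 ℕ.* h ℕ.+ 8 ℕ.* a₁ ℕ.+ 1 ℕ.+ 2 ∸ 2 ≡⟨ ℕ.m+n∸n≡m _ 2 ⟩
      4 ℕ.* h ℕ.+ 8 ℕ.* a₁ ℕ.+ 1          ∎
      where
      n/2≡4h : n / 2 ≡ 4 ℕ.* h
      n/2≡4h = trans (cong (_/ 2) (trans n≡h*8 (ℕ-ring′ h))) (m*n/n≡m (4 ℕ.* h) 2)
        where ℕ-ring′ : ∀ h → h ℕ.* 8 ≡ 4 ℕ.* h ℕ.* 2
              ℕ-ring′ = ℕ-Ring.solve-∀
      ℕ-ring : ∀ h x → 4 ℕ.* h ℕ.+ (8 ℕ.* x ℕ.+ 3) ≡ 4 ℕ.* h ℕ.+ 8 ℕ.* x ℕ.+ 1 ℕ.+ 2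
      ℕ-ring = ℕ-Ring.solve-∀
    square≡ : + (4 ℕ.* (a₀ ℕ.+ 1) ℕ.^ 2) ≡ + 4 * (+ a₁ + + a₁ + 1ℤ) * (+ a₁ + + a₁ + 1ℤ)
    square≡ = begin
      + (4 ℕ.* (a₀ ℕ.+ 1) ℕ.^ 2)
        ≡⟨ cong (λ x → + (4 ℕ.* (x ℕ.+ 1) ℕ.^ 2)) a₀≡a₁*2 ⟩
      + (4 ℕ.* (a₁ ℕ.* 2 ℕ.+ 1) ℕ.^ 2)
        ≡⟨ cong +_ (ℕ-ring a₁) ⟩
      + (4 ℕ.* e ℕ.* e)
        ≡⟨ trans (ℤ.pos-* (4 ℕ.* e) e) (cong (_* + e) (ℤ.pos-* 4 e)) ⟩
      + 4 * + e * + e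
        ≡⟨ cong (λ x → + 4 * x * x) (trans (ℤ.pos-+ (a₁ ℕ.+ a₁) 1) (cong (_+ 1ℤ) (ℤ.pos-+ a₁ a₁))) ⟩
      + 4 * (+ a₁ + + a₁ + 1ℤ) * (+ a₁ + + a₁ + 1ℤ) ∎
      where
      e : ℕ
      e = a₁ ℕ.+ a₁ ℕ.+ 1
      ℕ-ring : ∀ x → 4 ℕ.* ((x ℕ.* 2 ℕ.+ 1) ℕ.* ((x ℕ.* 2 ℕ.+ 1) ℕ.* 1)) ≡ 4 ℕ.* (x ℕ.+ x ℕ.+ 1) ℕ.* (x ℕ.+ x ℕ.+ 1)
      ℕ-ring = ℕ-Ring.solve-∀

data Layer : Set where
  outer inner : Layer

flip : Layer → Layer
flip outer = inner
flip inner = outer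

flip≢id : ∀ s → flip s ≢ s
flip≢id outer ()
flip≢id inner ()

flip-involutive : ∀ s → flip (flip s) ≡ s
flip-involutive outer = refl
flip-involutive inner = refl

fold-flip⇒even : ∀ s k → fold s flip k ≡ s → Even k
fold-flip⇒even s zero _ = ℕ.divides 0 refl
fold-flip⇒even s (suc zero) eq = ⊥-elim (flip≢id s eq)
fold-flip⇒even s (suc (suc k)) eq =
  ℕ.∣m∣n⇒∣m+n ℕ.∣-refl (fold-flip⇒even s k (trans (sym (flip-involutive _)) eq))

module Matchings (n′ a b : ℕ) (n-even : Even (suc n′)) (a-odd : Odd a) (b-odd : Odd b) where

  open ModularArithmetic
  open Arithmetic using (SwapCongruences; ConstructionData)
  open import Data.Nat.Base as ℕ using (ℕ; zero; suc; _<_; _∸_)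
  import Data.Nat.Properties as ℕ
  open import Data.Nat.DivMod using (_divMod_; DivMod)
  import Data.Nat.Tactic.RingSolver as ℕ-Ring
  open import Data.Integer.Base using (ℤ; +_; _+_; _-_; _*_; -_; 0ℤ; 1ℤ; -1ℤ)
  import Data.Integer.Properties as ℤ
  open import Data.Integer.Divisibility.Signed using (_∣_; divides; ∣⇒∣ᵤ)
  open import Data.Integer.Tactic.RingSolver using (solve-∀; solve)
  open import Data.List.Base using (_∷_; [])
  open import Data.Fin.Base as Fin using (Fin; toℕ)
  import Data.Fin.Properties as Fin
  open import Data.Fin.Patterns using (0F; 1F; 2F; 3F)
  open import Data.Product.Base using (Σ; _×_; _,_; proj₁; proj₂)
  open import Data.Sum.Base as Sum using (_⊎_; inj₁; inj₂)
  open import Function.Base using (_∘_; case_of_)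
  open import Function.Bundles using (_⇔_; mk⇔; Equivalence)
  open import Relation.Nullary.Decidable using (yes; no)
  open import Relation.Nullary.Negation using (¬_)
  open import Relation.Binary.PropositionalEquality

  open Residues n′ public

  n : ℕ
  n = suc n′

  at : Layer → Fin n → V n
  at outer = u
  at inner = v

  vtx : Layer → ℤ → V n
  vtx s x = at s (reduce x)

  layer : V n → Layer
  layer (u _) = outer
  layer (v _) = inner

  at-injective : ∀ {s i j} → at s i ≡ at s j → i ≡ j
  at-injective {outer} refl = refl
  at-injective {inner} refl = refl

  vtx-cong : ∀ {s x y} → x ≡ y mod n → vtx s x ≡ vtx s y
  vtx-cong x≡y = cong (at _) (reduce-cong x≡y)

  vtx-injective : ∀ {s x y} → vtx s x ≡ vtx s y → x ≡ y mod n
  vtx-injective eq = reduce-injective (at-injective eq)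

  vtx-toℕ : ∀ s i → vtx s (+ toℕ i) ≡ at s i
  vtx-toℕ s i = cong (at s) (reduce-toℕ i)

  by-vtx : (P : V n → Set) → (∀ s {x π} → ParitySign x π → P (vtx s x)) → ∀ p → P p
  by-vtx P P-vtx (u i) = subst P (vtx-toℕ outer i) (P-vtx outer (paritySign-sign (toℕ i)))
  by-vtx P P-vtx (v i) = subst P (vtx-toℕ inner i) (P-vtx inner (paritySign-sign (toℕ i)))

  vtx-view : ∀ p → Σ Layer λ s → Σ ℤ λ x → Σ ℤ λ π → ParitySign x π × p ≡ vtx s x
  vtx-view = by-vtx _ λ s x∶π → s , _ , _ , x∶π , refl

  -- The partner in a matching whose edges join index i to i + c for even i (c odd): it is i + (−1)^i·c.
  shift : (Layer → ℤ) → V n → V n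
  shift c (u i) = vtx outer (+ toℕ i + sign (toℕ i) * c outer)
  shift c (v i) = vtx inner (+ toℕ i + sign (toℕ i) * c inner)

  shift-at : ∀ c s i → shift c (at s i) ≡ vtx s (+ toℕ i + sign (toℕ i) * c s)
  shift-at c outer i = refl
  shift-at c inner i = refl

  layer-shift : ∀ c p → layer (shift c p) ≡ layer p
  layer-shift c (u i) = refl
  layer-shift c (v i) = refl

  blueStep greenStep : Layer → ℤ
  blueStep outer = 1ℤ
  blueStep inner = + b
  greenStep outer = -1ℤ
  greenStep inner = + a

  blueStep-odd : ∀ s → Oddℤ (blueStep s)
  blueStep-odd outer = 1-odd
  blueStep-odd inner = Odd⇒Oddℤ b-odd

  greenStep-odd : ∀ s → Oddℤ (greenStep s)
  greenStep-odd outer = odd -1ℤ refl refl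
  greenStep-odd inner = Odd⇒Oddℤ a-odd

  red blue green : V n → V n
  red (u i) = v i
  red (v i) = u i
  blue = shift blueStep
  green = shift greenStep

  red-vtx : ∀ s x → red (vtx s x) ≡ vtx (flip s) x
  red-vtx outer x = refl
  red-vtx inner x = refl

  layer-red : ∀ p → layer (red p) ≡ flip (layer p)
  layer-red (u i) = refl
  layer-red (v i) = refl

  red-involutive : ∀ p → red (red p) ≡ p
  red-involutive (u i) = refl
  red-involutive (v i) = refl

  record Moves (f : V n → V n) (s s′ : Layer) (c : ℤ) : Set where
    constructor moves
    field move : ∀ {x π} → ParitySign x π → f (vtx s x) ≡ vtx s′ (x + π * c)

  open Moves public

  shift-moves : ∀ c s → Moves (shift c) s s (c s)
  move (shift-moves c s) {x} {π} x∶π = begin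
    shift c (vtx s x)                                        ≡⟨ shift-at c s (reduce x) ⟩
    vtx s (+ toℕ (reduce x) + sign (toℕ (reduce x)) * c s)   ≡⟨ cong (λ ρ → vtx s (+ toℕ (reduce x) + ρ * c s)) sign≡π ⟩
    vtx s (+ toℕ (reduce x) + π * c s)                       ≡⟨ vtx-cong (mod-+ (toℕ-reduce x) (≡⇒mod refl)) ⟩
    vtx s (x + π * c s)                                      ∎
    where
    open ≡-Reasoning
    sign≡π : sign (toℕ (reduce x)) ≡ π
    sign≡π = paritySign-unique (paritySign-sign _) (paritySign-mod (Even⇒Evenℤ n-even) (toℕ-reduce x) x∶π)

  red-moves : ∀ s → Moves red s (flip s) 0ℤ
  move (red-moves s) {x} {π} _ = trans (red-vtx s x) (cong (vtx (flip s)) (ring x π))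
    where ring : ∀ x π → x ≡ x + π * 0ℤ
          ring = solve-∀

  moves-≡ : ∀ {f s s′ c d} → c ≡ d → Moves f s s′ c → Moves f s s′ d
  moves-≡ refl f-moves = f-moves

  moves-∘ : ∀ {f g s s′ s″ c d ρ} → Moves f s s′ c → ParitySign c ρ → Moves g s′ s″ d →
            Moves (g ∘ f) s s″ (c + ρ * d)
  move (moves-∘ {f} {g} {s} {s′} {s″} {c} {d} {ρ} f-moves c∶ρ g-moves) {x} {π} x∶π = begin
    g (f (vtx s x))                 ≡⟨ cong g (move f-moves x∶π) ⟩
    g (vtx s′ (x + π * c))          ≡⟨ move g-moves (paritySign-step x∶π c∶ρ) ⟩
    vtx s″ (x + π * c + π * ρ * d)  ≡⟨ cong (vtx s″) (ring x π c ρ d) ⟩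
    vtx s″ (x + π * (c + ρ * d))    ∎
    where
    open ≡-Reasoning
    ring : ∀ x π c ρ d → x + π * c + π * ρ * d ≡ x + π * (c + ρ * d)
    ring = solve-∀

  moves-fold : ∀ {f s c} → Moves f s s c → Evenℤ c → ∀ k → Moves (λ p → fold p f k) s s (+ k * c)
  move (moves-fold {s = s} {c} f-moves c-even zero) {x} {π} _ = cong (vtx s) (ring x π c)
    where ring : ∀ x π c → x ≡ x + π * (0ℤ * c)
          ring = solve-∀
  moves-fold {c = c} f-moves c-even (suc k) =
    moves-≡ (ring (+ k) c) (moves-∘ (moves-fold f-moves c-even k) (Evenℤ-*ˡ (+ k) c-even) f-moves)
    where ring : ∀ k c → k * c + 1ℤ * c ≡ (1ℤ + k) * c
          ring = solve-∀

  moves-involutive : ∀ {f s c} → Moves f s s c → Oddℤ c → ∀ {x π} → ParitySign x π → f (f (vtx s x)) ≡ vtx s x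
  moves-involutive {s = s} {c} f-moves c-odd {x} {π} x∶π =
    trans (move (moves-∘ f-moves c-odd f-moves) x∶π) (cong (vtx s) (ring x π c))
    where ring : ∀ x π c → x + π * (c + -1ℤ * c) ≡ x
          ring = solve-∀

  vtx-step-injective : ∀ {s x π c d} → ParitySign x π → vtx s (x + π * c) ≡ vtx s (x + π * d) → c ≡ d mod n
  vtx-step-injective {s} {x} {π} {c} {d} x∶π eq with vtx-injective {s} {x + π * c} {x + π * d} eq
  ... | congruent (divides q e) = congruent (divides (π * q) (begin
    c - d                              ≡⟨ ring₁ (c - d) ⟩
    1ℤ * (c - d)                       ≡⟨ cong (_* (c - d)) (sym (paritySign-square x∶π)) ⟩
    π * π * (c - d)                    ≡⟨ ring₂ x π c d ⟩
    π * ((x + π * c) - (x + π * d))    ≡⟨ cong (π *_) e ⟩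
    π * (q * + n)                      ≡⟨ ring₃ π q (+ n) ⟩
    π * q * + n                        ∎))
    where
    open ≡-Reasoning
    ring₁ : ∀ y → y ≡ 1ℤ * y
    ring₁ = solve-∀
    ring₂ : ∀ x π c d → π * π * (c - d) ≡ π * ((x + π * c) - (x + π * d))
    ring₂ = solve-∀
    ring₃ : ∀ π q n → π * (q * n) ≡ π * q * n
    ring₃ = solve-∀

  blue-involutive : ∀ p → blue (blue p) ≡ p
  blue-involutive = by-vtx _ λ s → moves-involutive (shift-moves blueStep s) (blueStep-odd s)

  green-involutive : ∀ p → green (green p) ≡ p
  green-involutive = by-vtx _ λ s → moves-involutive (shift-moves greenStep s) (greenStep-odd s)

  step-edge : ∀ c s i {k} → sign (toℕ i) * c s ≡ + k → shift c (at s i) ≡ at s (i ⊕ k)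
  step-edge c s i eq = trans (shift-at c s i) (cong (λ z → vtx s (+ toℕ i + z)) eq)

  mate-of-either : ∀ {E : V n → V n → Set} {f} → (∀ p → f (f p) ≡ p) →
                   (∀ {p q} → E p q → q ≡ f p) → ∀ {p q} → E p q ⊎ E q p → q ≡ f p
  mate-of-either f-involutive E⇒f (inj₁ e) = E⇒f e
  mate-of-either {f = f} f-involutive E⇒f {p} {q} (inj₂ e) = trans (sym (f-involutive q)) (cong f (sym (E⇒f e)))

  Rc⇒red : ∀ {p q} → Rc n a b p q → q ≡ red p
  Rc⇒red = mate-of-either {Rd n a b} {red} red-involutive λ { (r i) → refl }

  red-Rc : ∀ p → Rc n a b p (red p)
  red-Rc (u i) = inj₁ (r i)
  red-Rc (v i) = inj₂ (r i)

  even-index : ∀ {x} → Evenℤ x → Even (toℕ (reduce x))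
  even-index x-even = Evenℤ⇒Even (paritySign-mod (Even⇒Evenℤ n-even) (toℕ-reduce _) x-even)

  odd-index : ∀ {x} → Oddℤ x → Odd (toℕ (reduce x))
  odd-index x-odd = Oddℤ⇒Odd (paritySign-mod (Even⇒Evenℤ n-even) (toℕ-reduce _) x-odd)

  ⊕-reduce : ∀ s x k → at s (reduce x ⊕ k) ≡ vtx s (x + + k)
  ⊕-reduce s x k = vtx-cong (mod-+ (toℕ-reduce x) (≡⇒mod refl))

  a≢b-mod : a < b → b < n → ¬ (+ a ≡ + b mod n)
  a≢b-mod a<b b<n = 0<y-x<n⇒x≢y (ℕ.m<n⇒0<n∸m a<b) (ℕ.≤-<-trans (ℕ.m∸n≤m b a) b<n) (sym (pos-∸ (ℕ.<⇒≤ a<b)))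

  v₀vₐ∈G⇒¬CondA : a < b → b < n → V0VaInG n a b → ¬ CondA n a b
  v₀vₐ∈G⇒¬CondA a<b b<n (i , i≡0 , inj₁ g) = from-v₀ g refl refl
    where
    ⊕a≢⊕b : i ⊕ b ≢ i ⊕ a
    ⊕a≢⊕b eq = a≢b-mod a<b b<n
      (mod-scale (reduce-injective {+ toℕ i + + b} {+ toℕ i + + a} eq) -1ℤ (ring (+ toℕ i) (+ a) (+ b)))
      where ring : ∀ x a b → a - b ≡ -1ℤ * ((x + b) - (x + a))
            ring = solve-∀
    from-v₀ : ∀ {p q} → Gd n a b p q → p ≡ v i → q ≡ v (i ⊕ a) → ¬ CondA n a b
    from-v₀ (gu _ _) () _
    from-v₀ (gvA _ _ _) refl q≡ = ⊥-elim (⊕a≢⊕b (at-injective {inner} q≡))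
    from-v₀ (gvB _ _ ¬condA) _ _ = ¬condA
  v₀vₐ∈G⇒¬CondA a<b b<n (i , i≡0 , inj₂ g) = from-vₐ g refl
    where
    vₐ-odd : Odd (toℕ (i ⊕ a))
    vₐ-odd = odd-index (subst (λ k → Oddℤ (+ k + + a)) (sym i≡0) (Odd⇒Oddℤ a-odd))
    from-vₐ : ∀ {p q} → Gd n a b p q → p ≡ v (i ⊕ a) → ¬ CondA n a b
    from-vₐ (gu _ _) ()
    from-vₐ (gvA j j-even _) p≡ = ⊥-elim (vₐ-odd (subst (λ k → Even (toℕ k)) (at-injective {inner} p≡) j-even))
    from-vₐ (gvB j j-even _) p≡ = ⊥-elim (vₐ-odd (subst (λ k → Even (toℕ k)) (at-injective {inner} p≡) j-even))

  green≢blue : 2 < n → a < b → b < n → ∀ p → green p ≢ blue p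
  green≢blue 2<n a<b b<n = by-vtx _ λ s x∶π eq →
    steps-distinct s (vtx-step-injective x∶π (trans (sym (move (shift-moves greenStep s) x∶π))
                                                    (trans eq (move (shift-moves blueStep s) x∶π))))
    where
    steps-distinct : ∀ s → ¬ (greenStep s ≡ blueStep s mod n)
    steps-distinct outer = 0<y-x<n⇒x≢y (ℕ.s≤s ℕ.z≤n) 2<n refl
    steps-distinct inner = a≢b-mod a<b b<n

  green≢red : ∀ p → green p ≢ red p
  green≢red p eq = flip≢id (layer p)
      (trans (sym (layer-red p)) (trans (cong layer (sym eq)) (layer-shift greenStep p)))

  record SwapsBlueRed (σ : V n → V n) : Set where
    field
      involutive : ∀ p → σ (σ p) ≡ p
      blue-red : ∀ p → σ (blue p) ≡ red (σ p)
      green-green : ∀ p → σ (green p) ≡ green (σ p)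

    red-blue : ∀ p → σ (red p) ≡ blue (σ p)
    red-blue p = begin
      σ (red p)              ≡⟨ cong (σ ∘ red) (sym (involutive p)) ⟩
      σ (red (σ (σ p)))      ≡⟨ cong σ (sym (blue-red (σ p))) ⟩
      σ (σ (blue (σ p)))     ≡⟨ involutive _ ⟩
      blue (σ p)             ∎
      where open ≡-Reasoning

  module Colours (¬condA : ¬ CondA n a b) where

    Bd⇒blue : ∀ {p q} → Bd n a b p q → q ≡ blue p
    Bd⇒blue (bu i i-even) = sym (step-edge blueStep outer i (cong (_* 1ℤ) (sign-even i-even)))
    Bd⇒blue (bvA _ _ condA) = ⊥-elim (¬condA condA)
    Bd⇒blue (bvB j j-even _) =
      sym (step-edge blueStep inner j (trans (cong (_* + b) (sign-even j-even)) (ℤ.*-identityˡ (+ b))))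

    Gd⇒green : ∀ {p q} → Gd n a b p q → q ≡ green p
    Gd⇒green (gu i i-odd) = sym (step-edge greenStep outer i (cong (_* -1ℤ) (sign-odd i-odd)))
    Gd⇒green (gvA _ _ condA) = ⊥-elim (¬condA condA)
    Gd⇒green (gvB j j-even _) =
      sym (step-edge greenStep inner j (trans (cong (_* + a) (sign-even j-even)) (ℤ.*-identityˡ (+ a))))

    Bc⇒blue : ∀ {p q} → Bc n a b p q → q ≡ blue p
    Bc⇒blue = mate-of-either {Bd n a b} {blue} blue-involutive Bd⇒blue

    Gc⇒green : ∀ {p q} → Gc n a b p q → q ≡ green p
    Gc⇒green = mate-of-either {Gd n a b} {green} green-involutive Gd⇒green

    Bd-from-even : ∀ s {x} → Evenℤ x → Bd n a b (vtx s x) (vtx s (x + blueStep s))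
    Bd-from-even outer {x} x-even = subst (Bd n a b _) (⊕-reduce outer x 1) (bu _ (even-index x-even))
    Bd-from-even inner {x} x-even = subst (Bd n a b _) (⊕-reduce inner x b) (bvB _ (even-index x-even) ¬condA)

    blue-Bc : ∀ p → Bc n a b p (blue p)
    blue-Bc = by-vtx _ Bc-vtx
      where
      Bc-vtx : ∀ s {x π} → ParitySign x π → Bc n a b (vtx s x) (blue (vtx s x))
      Bc-vtx s {x} x∶π@(even _ _ refl) =
        inj₁ (subst (Bd n a b _) (sym (trans (move (shift-moves blueStep s) x∶π) (cong (λ c → vtx s (x + c)) (ℤ.*-identityˡ _))))
                    (Bd-from-even s x∶π))
      Bc-vtx s {x} x∶π@(odd _ _ refl) =
        inj₂ (subst₂ (Bd n a b) (sym (move (shift-moves blueStep s) x∶π)) (cong (vtx s) (ring x (blueStep s)))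
                     (Bd-from-even s (paritySign-step x∶π (blueStep-odd s))))
        where ring : ∀ x c → x + -1ℤ * c + c ≡ x
              ring = solve-∀

    Gd-from-odd-outer : ∀ {x} → Oddℤ x → Gd n a b (vtx outer x) (vtx outer (x + 1ℤ))
    Gd-from-odd-outer {x} x-odd = subst (Gd n a b _) (⊕-reduce outer x 1) (gu _ (odd-index x-odd))

    Gd-from-even-inner : ∀ {x} → Evenℤ x → Gd n a b (vtx inner x) (vtx inner (x + + a))
    Gd-from-even-inner {x} x-even = subst (Gd n a b _) (⊕-reduce inner x a) (gvB _ (even-index x-even) ¬condA)

    green-Gc : ∀ p → Gc n a b p (green p)
    green-Gc = by-vtx _ Gc-vtx
      where
      green-vtx : ∀ s {x π} → ParitySign x π → green (vtx s x) ≡ vtx s (x + π * greenStep s)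
      green-vtx s = move (shift-moves greenStep s)
      Gc-vtx : ∀ s {x π} → ParitySign x π → Gc n a b (vtx s x) (green (vtx s x))
      Gc-vtx outer x∶π@(odd _ _ refl) = inj₁ (subst (Gd n a b _) (sym (green-vtx outer x∶π)) (Gd-from-odd-outer x∶π))
      Gc-vtx outer {x} x∶π@(even _ _ refl) =
        inj₂ (subst₂ (Gd n a b) (sym (green-vtx outer x∶π)) (cong (vtx outer) (ring x))
                     (Gd-from-odd-outer (paritySign-step x∶π (greenStep-odd outer))))
        where ring : ∀ x → x + 1ℤ * -1ℤ + 1ℤ ≡ x
              ring = solve-∀
      Gc-vtx inner {x} x∶π@(even _ _ refl) =
        inj₁ (subst (Gd n a b _) (sym (trans (green-vtx inner x∶π) (cong (λ c → vtx inner (x + c)) (ℤ.*-identityˡ _))))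
                    (Gd-from-even-inner x∶π))
      Gc-vtx inner {x} x∶π@(odd _ _ refl) =
        inj₂ (subst₂ (Gd n a b) (sym (green-vtx inner x∶π)) (cong (vtx inner) (ring x (+ a)))
                     (Gd-from-even-inner (paritySign-step x∶π (greenStep-odd inner))))
        where ring : ∀ x c → x + -1ℤ * c + c ≡ x
              ring = solve-∀

    Mates : V n → V n → Set
    Mates p q = q ≡ red p ⊎ q ≡ blue p ⊎ q ≡ green p

    Ed⇒coloured : ∀ {p q} → Ed n a b p q → Rc n a b p q ⊎ Bc n a b p q ⊎ Gc n a b p q
    Ed⇒coloured (uu i) with 2 ℕ.∣? toℕ i
    ... | yes i-even = inj₂ (inj₁ (inj₁ (bu i i-even)))
    ... | no i-odd = inj₂ (inj₂ (inj₁ (gu i i-odd)))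
    Ed⇒coloured (uv i) = inj₁ (inj₁ (r i))
    Ed⇒coloured (va i i-even) = inj₂ (inj₂ (inj₁ (gvB i i-even ¬condA)))
    Ed⇒coloured (vb i i-even) = inj₂ (inj₁ (inj₁ (bvB i i-even ¬condA)))

    Rd⇒Ed : ∀ {p q} → Rd n a b p q → Ed n a b p q
    Rd⇒Ed (r i) = uv i

    Bd⇒Ed : ∀ {p q} → Bd n a b p q → Ed n a b p q
    Bd⇒Ed (bu i _) = uu i
    Bd⇒Ed (bvA j j-even _) = va j j-even
    Bd⇒Ed (bvB j j-even _) = vb j j-even

    Gd⇒Ed : ∀ {p q} → Gd n a b p q → Ed n a b p q
    Gd⇒Ed (gu i _) = uu i
    Gd⇒Ed (gvA j j-even _) = vb j j-even
    Gd⇒Ed (gvB j j-even _) = va j j-even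

    Adj⇔Mates : ∀ {p q} → Adj n a b p q ⇔ Mates p q
    Adj⇔Mates {p} {q} = mk⇔ Adj⇒Mates Mates⇒Adj
      where
      coloured⇒Mates : ∀ {p q} → Rc n a b p q ⊎ Bc n a b p q ⊎ Gc n a b p q → Mates p q
      coloured⇒Mates = Sum.map Rc⇒red (Sum.map Bc⇒blue Gc⇒green)
      Adj⇒Mates : Adj n a b p q → Mates p q
      Adj⇒Mates (inj₁ e) = coloured⇒Mates (Ed⇒coloured e)
      Adj⇒Mates (inj₂ e) = coloured⇒Mates (Sum.map Sum.swap (Sum.map Sum.swap Sum.swap) (Ed⇒coloured e))
      Mates⇒Adj : Mates p q → Adj n a b p q
      Mates⇒Adj (inj₁ refl) = Sum.map Rd⇒Ed Rd⇒Ed (red-Rc p)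
      Mates⇒Adj (inj₂ (inj₁ refl)) = Sum.map Bd⇒Ed Bd⇒Ed (blue-Bc p)
      Mates⇒Adj (inj₂ (inj₂ refl)) = Sum.map Gd⇒Ed Gd⇒Ed (green-Gc p)

    IsSwappingInvolution : (V n → V n) → Set
    IsSwappingInvolution σ = IsAutomorphism n a b σ × HasOrder2 σ
                             × MapsOnto σ (Bc n a b) (Rc n a b) × MapsOnto σ (Rc n a b) (Bc n a b)

    maps-onto : ∀ {E F : V n → V n → Set} {σ} (f g : V n → V n) → (∀ p → σ (σ p) ≡ p) →
                (∀ p → σ (f p) ≡ g (σ p)) → (∀ p → σ (g p) ≡ f (σ p)) →
                (∀ {p q} → E p q → q ≡ f p) → (∀ p → E p (f p)) →
                (∀ {p q} → F p q → q ≡ g p) → (∀ p → F p (g p)) → MapsOnto σ E F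
    maps-onto {E} {F} {σ} f g σ-involutive σf≡gσ σg≡fσ E⇒f E-f F⇒g F-g = image⊆F , F⊆image
      where
      image⊆F : ∀ p q → E p q → F (σ p) (σ q)
      image⊆F p q e = subst (F (σ p)) (sym (trans (cong σ (E⇒f e)) (σf≡gσ p))) (F-g (σ p))
      F⊆image : ∀ p q → F p q → Σ (V n) λ p′ → Σ (V n) λ q′ → E p′ q′ × σ p′ ≡ p × σ q′ ≡ q
      F⊆image p q e = σ p , σ q , subst (E (σ p)) (sym (trans (cong σ (F⇒g e)) (σg≡fσ p))) (E-f (σ p))
                    , σ-involutive p , σ-involutive q

    swap⇒swapping-involution : ∀ {σ} → SwapsBlueRed σ → IsSwappingInvolution σ
    swap⇒swapping-involution {σ} swap =
      (injective , (λ q → σ q , involutive q) , λ p q → mk⇔ preserves reflects)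
      , (involutive , nonfixed)
      , maps-onto blue red involutive blue-red red-blue Bc⇒blue blue-Bc Rc⇒red red-Rc
      , maps-onto red blue involutive red-blue blue-red Rc⇒red red-Rc Bc⇒blue blue-Bc
      where
      open SwapsBlueRed swap
      injective : ∀ p q → σ p ≡ σ q → p ≡ q
      injective p q eq = trans (sym (involutive p)) (trans (cong σ eq) (involutive q))
      σ-Mates : ∀ {p q} → Mates p q → Mates (σ p) (σ q)
      σ-Mates {p} (inj₁ refl) = inj₂ (inj₁ (red-blue p))
      σ-Mates {p} (inj₂ (inj₁ refl)) = inj₁ (blue-red p)
      σ-Mates {p} (inj₂ (inj₂ refl)) = inj₂ (inj₂ (green-green p))
      preserves : ∀ {p q} → Adj n a b p q → Adj n a b (σ p) (σ q)
      preserves adj = Equivalence.from Adj⇔Mates (σ-Mates (Equivalence.to Adj⇔Mates adj))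
      reflects : ∀ {p q} → Adj n a b (σ p) (σ q) → Adj n a b p q
      reflects {p} {q} adj = subst₂ (Adj n a b) (involutive p) (involutive q) (preserves adj)
      nonfixed : Σ (V n) λ p → σ p ≢ p
      nonfixed with σ (u Fin.zero) in σu₀≡
      ... | v i = u Fin.zero , λ σu₀≡u₀ → case trans (sym σu₀≡) σu₀≡u₀ of λ ()
      ... | u i = v Fin.zero , λ σv₀≡v₀ → case layers-agree σv₀≡v₀ of λ ()
        where
        layers-agree : σ (v Fin.zero) ≡ v Fin.zero → inner ≡ outer
        layers-agree σv₀≡v₀ =
          trans (cong layer (sym σv₀≡v₀)) (cong layer (trans (red-blue (u Fin.zero)) (cong blue σu₀≡)))

    swapping-involution⇒swap : 2 < n → a < b → b < n → ∀ {σ} → IsSwappingInvolution σ → SwapsBlueRed σ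
    swapping-involution⇒swap 2<n a<b b<n {σ} ((injective , _ , adj) , (involutive , _) , (B→R , _) , (R→B , _)) =
      record { involutive = involutive ; blue-red = blue-red ; green-green = green-green }
      where
      blue-red : ∀ p → σ (blue p) ≡ red (σ p)
      blue-red p = Rc⇒red (B→R p (blue p) (blue-Bc p))
      red-blue : ∀ p → σ (red p) ≡ blue (σ p)
      red-blue p = Bc⇒blue (R→B p (red p) (red-Rc p))
      green-green : ∀ p → σ (green p) ≡ green (σ p)
      green-green p with Equivalence.to Adj⇔Mates (Equivalence.to (adj p (green p)) (Equivalence.from Adj⇔Mates (inj₂ (inj₂ refl))))
      ... | inj₁ σg≡rσ = ⊥-elim (green≢blue 2<n a<b b<n p (injective _ _ (trans σg≡rσ (sym (blue-red p)))))
      ... | inj₂ (inj₁ σg≡bσ) = ⊥-elim (green≢red p (injective _ _ (trans σg≡bσ (sym (red-blue p)))))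
      ... | inj₂ (inj₂ σg≡gσ) = σg≡gσ

  gb gr rb br : V n → V n
  gb = green ∘ blue
  gr = green ∘ red
  rb = red ∘ blue
  br = blue ∘ red

  gr²-step gb²-step rb²-step : Layer → ℤ
  gr²-step s = greenStep (flip s) - greenStep s
  gb²-step s = (blueStep s - greenStep s) + (blueStep s - greenStep s)
  rb²-step s = blueStep s - blueStep (flip s)

  blue-green-even : ∀ s → Evenℤ (blueStep s - greenStep s)
  blue-green-even s = subst Evenℤ (+-1*≡- (blueStep s) (greenStep s))
      (paritySign-step (blueStep-odd s) (greenStep-odd s))

  gr²-step-even : ∀ s → Evenℤ (gr²-step s)
  gr²-step-even s = subst Evenℤ (+-1*≡- (greenStep (flip s)) (greenStep s))
      (paritySign-step (greenStep-odd (flip s)) (greenStep-odd s))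

  gb²-step-even : ∀ s → Evenℤ (gb²-step s)
  gb²-step-even s = subst Evenℤ (+1*≡+ (blueStep s - greenStep s) (blueStep s - greenStep s))
      (paritySign-step (blue-green-even s) (blue-green-even s))

  gb-moves : ∀ s → Moves gb s s (blueStep s - greenStep s)
  gb-moves s = moves-≡ (+-1*≡- (blueStep s) (greenStep s))
      (moves-∘ (shift-moves blueStep s) (blueStep-odd s) (shift-moves greenStep s))

  gb²-moves : ∀ s → Moves (gb ∘ gb) s s (gb²-step s)
  gb²-moves s = moves-≡ (+1*≡+ (blueStep s - greenStep s) (blueStep s - greenStep s))
      (moves-∘ (gb-moves s) (blue-green-even s) (gb-moves s))

  gr-moves : ∀ s → Moves gr s (flip s) (greenStep (flip s))
  gr-moves s = moves-≡ (trans (+1*≡+ 0ℤ (greenStep (flip s))) (ℤ.+-identityˡ (greenStep (flip s))))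
      (moves-∘ (red-moves s) 0-even (shift-moves greenStep (flip s)))

  gr²-moves : ∀ s → Moves (gr ∘ gr) s s (gr²-step s)
  gr²-moves outer = moves-≡ (+-1*≡- (greenStep inner) (greenStep outer))
      (moves-∘ (gr-moves outer) (greenStep-odd inner) (gr-moves inner))
  gr²-moves inner = moves-≡ (+-1*≡- (greenStep outer) (greenStep inner))
      (moves-∘ (gr-moves inner) (greenStep-odd outer) (gr-moves outer))

  rb-moves : ∀ s → Moves rb s (flip s) (blueStep s)
  rb-moves s = moves-≡ (trans (+-1*≡- (blueStep s) 0ℤ) (ℤ.+-identityʳ (blueStep s)))
      (moves-∘ (shift-moves blueStep s) (blueStep-odd s) (red-moves s))

  rb²-moves : ∀ s → Moves (rb ∘ rb) s s (rb²-step s)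
  rb²-moves outer = moves-≡ (+-1*≡- (blueStep outer) (blueStep inner))
      (moves-∘ (rb-moves outer) (blueStep-odd outer) (rb-moves inner))
  rb²-moves inner = moves-≡ (+-1*≡- (blueStep inner) (blueStep outer))
      (moves-∘ (rb-moves inner) (blueStep-odd inner) (rb-moves outer))

  br-moves : ∀ s → Moves br s (flip s) (blueStep (flip s))
  br-moves s = moves-≡ (trans (+1*≡+ 0ℤ (blueStep (flip s))) (ℤ.+-identityˡ (blueStep (flip s))))
      (moves-∘ (red-moves s) 0-even (shift-moves blueStep (flip s)))

  layer-gr : ∀ p → layer (gr p) ≡ flip (layer p)
  layer-gr p = trans (layer-shift greenStep (red p)) (layer-red p)

  layer-gb : ∀ p → layer (gb p) ≡ layer p
  layer-gb p = trans (layer-shift greenStep (blue p)) (layer-shift blueStep p)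

  layer-rb : ∀ p → layer (rb p) ≡ flip (layer p)
  layer-rb p = trans (layer-red (blue p)) (cong flip (layer-shift blueStep p))

  layer-fold-gr : ∀ k p → layer (fold p gr k) ≡ fold (layer p) flip k
  layer-fold-gr zero p = refl
  layer-fold-gr (suc k) p = trans (layer-gr (fold p gr k)) (cong flip (layer-fold-gr k p))

  module Necessity {σ : V n → V n} (swap : SwapsBlueRed σ) where
    open SwapsBlueRed swap

    σ-gb : ∀ p → σ (gb p) ≡ gr (σ p)
    σ-gb p = trans (green-green (blue p)) (cong green (blue-red p))

    σ-gr : ∀ p → σ (gr p) ≡ gb (σ p)
    σ-gr p = trans (green-green (red p)) (cong green (red-blue p))

    σ-br : ∀ p → σ (br p) ≡ rb (σ p)
    σ-br p = trans (blue-red (red p)) (cong red (red-blue p))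

    u₀ w : V n
    u₀ = vtx outer 0ℤ
    w = σ u₀

    -- From u₀, gb^c₁ and gr² both reach u_{a+1}, gb^c₂ and br² both reach u_{b−1}, and gb ∘ gr² and
    -- gr² ∘ gb both reach u_{a+3}; σ transports these coincidences to w.
    gb-walk : ∀ c → fold u₀ gb c ≡ vtx outer (+ c + + c)
    gb-walk c = trans (move (moves-fold (gb-moves outer) (blue-green-even outer) c) 0-even)
                      (cong (vtx outer) (ring (+ c)))
      where ring : ∀ c → 0ℤ + 1ℤ * (c * (1ℤ - -1ℤ)) ≡ c + c
            ring = solve-∀

    transport-walk : ∀ c (f g : V n → V n) → fold u₀ gb c ≡ f u₀ → (∀ p → σ (f p) ≡ g (σ p)) → fold w gr c ≡ g w
    transport-walk c f g walk σf≡gσ = trans (sym (fold-intertwine {σ = σ} {gb} {gr} σ-gb c u₀))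
        (trans (cong σ walk) (σf≡gσ u₀))

    gr²-walk : gr (gr u₀) ≡ vtx outer (+ a + 1ℤ)
    gr²-walk = trans (move (gr²-moves outer) 0-even) (cong (vtx outer) (ring (+ a)))
      where ring : ∀ a → 0ℤ + 1ℤ * (a - -1ℤ) ≡ a + 1ℤ
            ring = solve-∀

    br²-walk : br (br u₀) ≡ vtx outer (+ b - 1ℤ)
    br²-walk = trans (move (moves-∘ (br-moves outer) (blueStep-odd inner) (br-moves inner)) 0-even)
                     (cong (vtx outer) (ring (+ b)))
      where ring : ∀ b → 0ℤ + 1ℤ * (b + -1ℤ * 1ℤ) ≡ b - 1ℤ
            ring = solve-∀

    a≡2h+1 : Σ ℕ λ h → a ≡ suc (h ℕ.+ h)
    a≡2h+1 = odd⇒suc-double a-odd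

    b≡2h′+1 : Σ ℕ λ h′ → b ≡ suc (h′ ℕ.+ h′)
    b≡2h′+1 = odd⇒suc-double b-odd

    c₁ c₂ : ℕ
    c₁ = suc (proj₁ a≡2h+1)
    c₂ = proj₁ b≡2h′+1

    c₁+c₁≡a+1 : + c₁ + + c₁ ≡ + a + 1ℤ
    c₁+c₁≡a+1 = begin
      + c₁ + + c₁            ≡⟨ sym (ℤ.pos-+ c₁ c₁) ⟩
      + (c₁ ℕ.+ c₁)          ≡⟨ cong (+_ ∘ suc) (trans (ℕ.+-suc h h) (sym (proj₂ a≡2h+1))) ⟩
      1ℤ + + a               ≡⟨ ℤ.+-comm 1ℤ (+ a) ⟩
      + a + 1ℤ               ∎
      where open ≡-Reasoning
            h = proj₁ a≡2h+1

    c₂+c₂≡b-1 : + c₂ + + c₂ ≡ + b - 1ℤ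
    c₂+c₂≡b-1 = begin
      + c₂ + + c₂            ≡⟨ sym (ℤ.pos-+ c₂ c₂) ⟩
      + (c₂ ℕ.+ c₂)          ≡⟨ ring (+ (c₂ ℕ.+ c₂)) ⟩
      1ℤ + + (c₂ ℕ.+ c₂) - 1ℤ ≡⟨ cong (λ m → + m - 1ℤ) (sym (proj₂ b≡2h′+1)) ⟩
      + b - 1ℤ               ∎
      where open ≡-Reasoning
            ring : ∀ x → x ≡ 1ℤ + x - 1ℤ
            ring = solve-∀

    gr^c₁≡gb² : fold w gr c₁ ≡ gb (gb w)
    gr^c₁≡gb² = transport-walk c₁ (gr ∘ gr) (gb ∘ gb)
      (trans (gb-walk c₁) (trans (cong (vtx outer) c₁+c₁≡a+1) (sym gr²-walk)))
      (λ p → trans (σ-gr (gr p)) (cong gb (σ-gr p)))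

    gr^c₂≡rb² : fold w gr c₂ ≡ rb (rb w)
    gr^c₂≡rb² = transport-walk c₂ (br ∘ br) (rb ∘ rb)
      (trans (gb-walk c₂) (trans (cong (vtx outer) c₂+c₂≡b-1) (sym br²-walk)))
      (λ p → trans (σ-br (br p)) (cong rb (σ-br p)))

    gr∘gb²≡gb²∘gr : gr (gb (gb w)) ≡ gb (gb (gr w))
    gr∘gb²≡gb²∘gr = begin
      gr (gb (gb w))            ≡⟨ cong gr (sym (trans (σ-gr (gr u₀)) (cong gb (σ-gr u₀)))) ⟩
      gr (σ (gr (gr u₀)))       ≡⟨ sym (σ-gb (gr (gr u₀))) ⟩
      σ (gb (gr (gr u₀)))       ≡⟨ cong σ (trans lhs (sym rhs)) ⟩
      σ (gr (gr (gb u₀)))       ≡⟨ σ-gr (gr (gb u₀)) ⟩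
      gb (σ (gr (gb u₀)))       ≡⟨ cong gb (σ-gr (gb u₀)) ⟩
      gb (gb (σ (gb u₀)))       ≡⟨ cong (gb ∘ gb) (σ-gb u₀) ⟩
      gb (gb (gr w))            ∎
      where
      open ≡-Reasoning
      lhs : gb (gr (gr u₀)) ≡ vtx outer (0ℤ + 1ℤ * (gr²-step outer + 1ℤ * (blueStep outer - greenStep outer)))
      lhs = move (moves-∘ (gr²-moves outer) (gr²-step-even outer) (gb-moves outer)) 0-even
      rhs : gr (gr (gb u₀)) ≡ vtx outer (0ℤ + 1ℤ * (gr²-step outer + 1ℤ * (blueStep outer - greenStep outer)))
      rhs = trans (move (moves-∘ (gb-moves outer) (blue-green-even outer) (gr²-moves outer)) 0-even)
                  (cong (vtx outer) (ring (gr²-step outer) (blueStep outer - greenStep outer)))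
        where ring : ∀ t d → 0ℤ + 1ℤ * (d + 1ℤ * t) ≡ 0ℤ + 1ℤ * (t + 1ℤ * d)
              ring = solve-∀

    c₁-even : Even c₁
    c₁-even = fold-flip⇒even (layer w) c₁ (begin
      fold (layer w) flip c₁  ≡⟨ sym (layer-fold-gr c₁ w) ⟩
      layer (fold w gr c₁)    ≡⟨ cong layer gr^c₁≡gb² ⟩
      layer (gb (gb w))       ≡⟨ trans (layer-gb _) (layer-gb w) ⟩
      layer w                 ∎)
      where open ≡-Reasoning

    c₂-even : Even c₂
    c₂-even = fold-flip⇒even (layer w) c₂ (begin
      fold (layer w) flip c₂  ≡⟨ sym (layer-fold-gr c₂ w) ⟩
      layer (fold w gr c₂)    ≡⟨ cong layer gr^c₂≡rb² ⟩
      layer (rb (rb w))       ≡⟨ trans (layer-rb _) (cong flip (layer-rb w)) ⟩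
      flip (flip (layer w))   ≡⟨ flip-involutive (layer w) ⟩
      layer w                 ∎)
      where open ≡-Reasoning

    k j : ℕ
    k = proj₁ (even⇒double c₁-even)
    j = proj₁ (even⇒double c₂-even)

    gr-walk : ∀ {c} m → c ≡ m ℕ.+ m → ∀ s {x π} → ParitySign x π →
              fold (vtx s x) gr c ≡ vtx s (x + π * (+ m * gr²-step s))
    gr-walk m refl s x∶π = trans (fold-double gr m _) (move (moves-fold (gr²-moves s) (gr²-step-even s) m) x∶π)

    module _ (s : Layer) {x π} (x∶π : ParitySign x π) (w≡ : w ≡ vtx s x) where

      k·gr²-step≡gb²-step : + k * gr²-step s ≡ gb²-step s mod n
      k·gr²-step≡gb²-step = vtx-step-injective x∶π (begin
        vtx s (x + π * (+ k * gr²-step s))  ≡⟨ sym (gr-walk k (proj₂ (even⇒double c₁-even)) s x∶π) ⟩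
        fold (vtx s x) gr c₁                ≡⟨ subst (λ p → fold p gr c₁ ≡ gb (gb p)) w≡ gr^c₁≡gb² ⟩
        gb (gb (vtx s x))                   ≡⟨ move (gb²-moves s) x∶π ⟩
        vtx s (x + π * gb²-step s)          ∎)
        where open ≡-Reasoning

      j·gr²-step≡rb²-step : + j * gr²-step s ≡ rb²-step s mod n
      j·gr²-step≡rb²-step = vtx-step-injective x∶π (begin
        vtx s (x + π * (+ j * gr²-step s))  ≡⟨ sym (gr-walk j (proj₂ (even⇒double c₂-even)) s x∶π) ⟩
        fold (vtx s x) gr c₂                ≡⟨ subst (λ p → fold p gr c₂ ≡ rb (rb p)) w≡ gr^c₂≡rb² ⟩
        rb (rb (vtx s x))                   ≡⟨ move (rb²-moves s) x∶π ⟩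
        vtx s (x + π * rb²-step s)          ∎)
        where open ≡-Reasoning

      gb²-then-gr≡gr-then-gb² : gb²-step s + 1ℤ * greenStep (flip s)
                              ≡ greenStep (flip s) + -1ℤ * gb²-step (flip s) mod n
      gb²-then-gr≡gr-then-gb² = vtx-step-injective x∶π (begin
        vtx (flip s) (x + π * (gb²-step s + 1ℤ * greenStep (flip s)))
          ≡⟨ sym (move (moves-∘ (gb²-moves s) (gb²-step-even s) (gr-moves s)) x∶π) ⟩
        gr (gb (gb (vtx s x)))
          ≡⟨ subst (λ p → gr (gb (gb p)) ≡ gb (gb (gr p))) w≡ gr∘gb²≡gb²∘gr ⟩
        gb (gb (gr (vtx s x)))
          ≡⟨ move (moves-∘ (gr-moves s) (greenStep-odd (flip s)) (gb²-moves (flip s))) x∶π ⟩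
        vtx (flip s) (x + π * (greenStep (flip s) + -1ℤ * gb²-step (flip s))) ∎)
        where open ≡-Reasoning

    CongruenceTriple : Set
    CongruenceTriple = (+ k * (+ a + 1ℤ) ≡ + 4 mod n) × (+ 2 * (+ b - + a) + + 4 ≡ 0ℤ mod n)
                       × (+ j * (+ a + 1ℤ) + + b - 1ℤ ≡ 0ℤ mod n)

    triple-at : ∀ s → + k * gr²-step s ≡ gb²-step s mod n → + j * gr²-step s ≡ rb²-step s mod n →
                gb²-step s + 1ℤ * greenStep (flip s) ≡ greenStep (flip s) + -1ℤ * gb²-step (flip s) mod n →
                CongruenceTriple
    triple-at outer e₁ e₂ e₃ =
      mod-scale e₁ 1ℤ (ring₁ (+ k) (+ a)) , mod-scale e₃ 1ℤ (ring₂ (+ a) (+ b)) ,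
      mod-scale e₂ 1ℤ (ring₃ (+ j) (+ a) (+ b))
      where
      ring₁ : ∀ k a → k * (a + 1ℤ) - + 4 ≡ 1ℤ * (k * (a - -1ℤ) - ((1ℤ - -1ℤ) + (1ℤ - -1ℤ)))
      ring₁ = solve-∀
      ring₂ : ∀ a b → + 2 * (b - a) + + 4 - 0ℤ
                      ≡ 1ℤ * (((1ℤ - -1ℤ) + (1ℤ - -1ℤ) + 1ℤ * a) - (a + -1ℤ * ((b - a) + (b - a))))
      ring₂ = solve-∀
      ring₃ : ∀ j a b → j * (a + 1ℤ) + b - 1ℤ - 0ℤ ≡ 1ℤ * (j * (a - -1ℤ) - (1ℤ - b))
      ring₃ = solve-∀
    triple-at inner e₁ e₂ e₃ = N₁ , N₂ , mod-scale e₂ -1ℤ (ring₃ (+ j) (+ a) (+ b))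
      where
      N₂ : + 2 * (+ b - + a) + + 4 ≡ 0ℤ mod n
      N₂ = mod-scale e₃ 1ℤ (ring₂ (+ a) (+ b))
        where ring₂ : ∀ a b → + 2 * (b - a) + + 4 - 0ℤ
                              ≡ 1ℤ * (((b - a) + (b - a) + 1ℤ * -1ℤ) - (-1ℤ + -1ℤ * ((1ℤ - -1ℤ) + (1ℤ - -1ℤ))))
              ring₂ = solve-∀
      N₁ : + k * (+ a + 1ℤ) ≡ + 4 mod n
      N₁ = mod-combine e₁ N₂ -1ℤ -1ℤ (ring₁ (+ k) (+ a) (+ b))
        where ring₁ : ∀ k a b → k * (a + 1ℤ) - + 4
                                ≡ -1ℤ * (k * (-1ℤ - a) - ((b - a) + (b - a))) + -1ℤ * (+ 2 * (b - a) + + 4 - 0ℤ)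
              ring₁ = solve-∀
      ring₃ : ∀ j a b → j * (a + 1ℤ) + b - 1ℤ - 0ℤ ≡ -1ℤ * (j * (-1ℤ - a) - (b - 1ℤ))
      ring₃ = solve-∀

    triple : CongruenceTriple
    triple = from-view (vtx-view w)
      where
      from-view : (Σ Layer λ s → Σ ℤ λ x → Σ ℤ λ π → ParitySign x π × w ≡ vtx s x) → CongruenceTriple
      from-view (s , x , π , x∶π , w≡) =
        triple-at s (k·gr²-step≡gb²-step s x∶π w≡) (j·gr²-step≡rb²-step s x∶π w≡) (gb²-then-gr≡gr-then-gb² s x∶π w≡)

    congruences : SwapCongruences n a b
    congruences = record
      { k = k ; j = j ; a+1≡4k = a+1≡4k ; b≡4j+1 = b≡4j+1
      ; k[a+1]≡4 = proj₁ triple ; 2[b-a]+4≡0 = proj₁ (proj₂ triple) ; j[a+1]+b-1≡0 = proj₂ (proj₂ triple) }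
      where
      a+1≡4k : a ℕ.+ 1 ≡ 4 ℕ.* k
      a+1≡4k = begin
        a ℕ.+ 1                               ≡⟨ cong (ℕ._+ 1) (proj₂ a≡2h+1) ⟩
        suc (h ℕ.+ h) ℕ.+ 1                   ≡⟨ ℕ-ring₁ h ⟩
        suc h ℕ.+ suc h                       ≡⟨ cong (λ c → c ℕ.+ c) (proj₂ (even⇒double c₁-even)) ⟩
        (k ℕ.+ k) ℕ.+ (k ℕ.+ k)               ≡⟨ ℕ-ring₂ k ⟩
        4 ℕ.* k                               ∎
        where
        open ≡-Reasoning
        h = proj₁ a≡2h+1
        ℕ-ring₁ : ∀ h → suc (h ℕ.+ h) ℕ.+ 1 ≡ suc h ℕ.+ suc h
        ℕ-ring₁ = ℕ-Ring.solve-∀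
        ℕ-ring₂ : ∀ k → (k ℕ.+ k) ℕ.+ (k ℕ.+ k) ≡ 4 ℕ.* k
        ℕ-ring₂ = ℕ-Ring.solve-∀
      b≡4j+1 : b ≡ 4 ℕ.* j ℕ.+ 1
      b≡4j+1 = begin
        b                                     ≡⟨ proj₂ b≡2h′+1 ⟩
        suc (c₂ ℕ.+ c₂)                       ≡⟨ cong (λ c → suc (c ℕ.+ c)) (proj₂ (even⇒double c₂-even)) ⟩
        suc ((j ℕ.+ j) ℕ.+ (j ℕ.+ j))         ≡⟨ ℕ-ring j ⟩
        4 ℕ.* j ℕ.+ 1                         ∎
        where
        open ≡-Reasoning
        ℕ-ring : ∀ j → suc ((j ℕ.+ j) ℕ.+ (j ℕ.+ j)) ≡ 4 ℕ.* j ℕ.+ 1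
        ℕ-ring = ℕ-Ring.solve-∀

  module Construction (H A₁ : ℤ) (n≡8H : + n ≡ + 8 * H) (a≡8A₁+3 : + a ≡ + 8 * A₁ + + 3)
                      (b≡4H+8A₁+1 : + b ≡ + 4 * H + + 8 * A₁ + + 1)
                      (square : + 4 * (A₁ + A₁ + 1ℤ) * (A₁ + A₁ + 1ℤ) ≡ + 4 mod n) where

    E C A B : ℤ
    E = A₁ + A₁ + 1ℤ
    C = + 4 * E
    A = + 8 * A₁ + + 3
    B = + 4 * H + + 8 * A₁ + + 1

    -- A certificate that x ≡ 0 (mod n): an integer combination of C·E − 4 (≡ 0 by `square`) and 8H = n.
    record Negligible (x : ℤ) : Set where
      constructor combination
      field
        m m′ : ℤ
        x≡ : x ≡ m * (C * E - + 4) + m′ * (+ 8 * H)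

    negligible⇒mod : ∀ {x y} → Negligible (x - y) → x ≡ y mod n
    negligible⇒mod {x} {y} (combination m m′ x-y≡) = congruent (divides (m * q + m′) (begin
      x - y                                ≡⟨ x-y≡ ⟩
      m * (C * E - + 4) + m′ * (+ 8 * H)   ≡⟨ cong₂ (λ D N → m * D + m′ * N) CE-4≡qn (sym n≡8H) ⟩
      m * (q * + n) + m′ * + n             ≡⟨ ring m q m′ (+ n) ⟩
      (m * q + m′) * + n                   ∎))
      where
      open ≡-Reasoning
      open _≡_mod_ square using () renaming (divides-difference to CE-4∣)
      q = _∣_.quotient CE-4∣
      CE-4≡qn = _∣_.equality CE-4∣
      ring : ∀ m q m′ n → m * (q * n) + m′ * n ≡ (m * q + m′) * n
      ring = solve-∀

    β γ : Layer → ℤ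
    β outer = 1ℤ
    β inner = B
    γ outer = -1ℤ
    γ inner = A

    blueStep≡β : ∀ s → blueStep s ≡ β s
    blueStep≡β outer = refl
    blueStep≡β inner = b≡4H+8A₁+1

    greenStep≡γ : ∀ s → greenStep s ≡ γ s
    greenStep≡γ outer = refl
    greenStep≡γ inner = a≡8A₁+3

    τ : Layer → Fin 4 → Layer
    τ outer 0F = outer
    τ outer 1F = inner
    τ outer 2F = inner
    τ outer 3F = outer
    τ inner 0F = outer
    τ inner 1F = inner
    τ inner 2F = inner
    τ inner 3F = outer

    κ : Layer → Fin 4 → ℤ
    κ outer 0F = 0ℤ
    κ outer 1F = 0ℤ
    κ outer 2F = A
    κ outer 3F = A
    κ inner 0F = 1ℤ
    κ inner 1F = B
    κ inner 2F = B - A + + 4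
    κ inner 3F = A - 1ℤ

    blockwise : Layer → Fin n → V n
    blockwise s i = vtx (τ s ρ) (C * + q + κ s ρ)
      where open DivMod (toℕ i divMod 4) renaming (quotient to q; remainder to ρ)

    σ : V n → V n
    σ (u i) = blockwise outer i
    σ (v i) = blockwise inner i

    σ-at : ∀ s i → σ (at s i) ≡ blockwise s i
    σ-at outer i = refl
    σ-at inner i = refl

    divMod-ℤ : ∀ m → + m ≡ + 4 * + DivMod.quotient (m divMod 4) + + toℕ (DivMod.remainder (m divMod 4))
    divMod-ℤ m = begin
      + m                  ≡⟨ cong +_ (DivMod.property (m divMod 4)) ⟩
      + (toℕ ρ ℕ.+ q ℕ.* 4) ≡⟨ trans (ℤ.pos-+ (toℕ ρ) (q ℕ.* 4)) (cong (λ x → + toℕ ρ + x) (ℤ.pos-* q 4)) ⟩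
      + toℕ ρ + + q * + 4  ≡⟨ ring (+ toℕ ρ) (+ q) ⟩
      + 4 * + q + + toℕ ρ  ∎
      where
      open ≡-Reasoning
      open DivMod (m divMod 4) renaming (quotient to q; remainder to ρ)
      ring : ∀ ρ q → ρ + q * + 4 ≡ + 4 * q + ρ
      ring = solve-∀

    4∣n : 4 ℕ.∣ n
    4∣n = ∣⇒∣ᵤ (divides (+ 2 * H) (trans n≡8H (ring H)))
      where ring : ∀ H → + 8 * H ≡ + 2 * H * + 4
            ring = solve-∀

    -- Well defined because 4 ∣ C: the value C·K only depends on 4K modulo n.
    σ-block : ∀ s K ρ → σ (vtx s (+ 4 * K + + toℕ ρ)) ≡ vtx (τ s ρ) (C * K + κ s ρ)
    σ-block s K ρ = trans (σ-at s i) (subst (λ ρ′ → vtx (τ s ρ′) (C * + q + κ s ρ′) ≡ vtx (τ s ρ) (C * K + κ s ρ))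
                                             (sym ρ′≡ρ) (vtx-cong (mod-+ Cq≡CK (≡⇒mod refl))))
      where
      i = reduce (+ 4 * K + + toℕ ρ)
      open DivMod (toℕ i divMod 4) renaming (quotient to q; remainder to ρ′)
      4q+ρ′≡4K+ρ : + 4 * + q + + toℕ ρ′ ≡ + 4 * K + + toℕ ρ mod n
      4q+ρ′≡4K+ρ = mod-trans (≡⇒mod (sym (divMod-ℤ (toℕ i)))) (toℕ-reduce _)
      ρ′≡ρ : ρ′ ≡ ρ
      ρ′≡ρ = Fin.toℕ-injective (residue-unique (Fin.toℕ<n ρ′) (Fin.toℕ<n ρ)
               (mod-combine (mod-weaken 4∣n 4q+ρ′≡4K+ρ) (multiple≡0 (K - + q)) 1ℤ 1ℤ (ring (+ q) K (+ toℕ ρ′) (+ toℕ ρ))))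
        where ring : ∀ q K ρ′ ρ → ρ′ - ρ ≡ 1ℤ * ((+ 4 * q + ρ′) - (+ 4 * K + ρ)) + 1ℤ * ((K - q) * + 4 - 0ℤ)
              ring = solve-∀
      Cq≡CK : C * + q ≡ C * K mod n
      Cq≡CK = mod-scale 4q+ρ′≡4K+ρ E
          (trans (ring E (+ q) K (+ toℕ ρ))
          (cong (λ x → E * ((+ 4 * + q + + toℕ x) - (+ 4 * K + + toℕ ρ))) (sym ρ′≡ρ)))
        where ring : ∀ E q K ρ → + 4 * E * q - + 4 * E * K ≡ E * ((+ 4 * q + ρ) - (+ 4 * K + ρ))
              ring = solve-∀

    vtx-divMod : ∀ s i → let open DivMod (toℕ i divMod 4) in vtx s (+ 4 * + quotient + + toℕ remainder) ≡ at s i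
    vtx-divMod s i = trans (cong (vtx s) (sym (divMod-ℤ (toℕ i)))) (vtx-toℕ s i)

    by-block : (P : V n → Set) → (∀ s K (ρ : Fin 4) → P (vtx s (+ 4 * K + + toℕ ρ))) → ∀ p → P p
    by-block P P-block (u i) = subst P (vtx-divMod outer i) (P-block outer (+ quotient) remainder)
      where open DivMod (toℕ i divMod 4)
    by-block P P-block (v i) = subst P (vtx-divMod inner i) (P-block inner (+ quotient) remainder)
      where open DivMod (toℕ i divMod 4)

    block-parity : ∀ K (ρ : Fin 4) → ParitySign (+ 4 * K + + toℕ ρ) (sign (toℕ ρ))
    block-parity K ρ = subst (λ x → ParitySign x (sign (toℕ ρ))) (ring (+ toℕ ρ) K)
        (paritySign-+double (paritySign-sign (toℕ ρ)) (+ 2 * K))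
      where ring : ∀ ρ K → ρ + (+ 2 * K + + 2 * K) ≡ + 4 * K + ρ
            ring = solve-∀

    regroup : ∀ K {ρ x d ρ′} → ρ + x ≡ + 4 * d + ρ′ → + 4 * K + ρ + x ≡ + 4 * (K + d) + ρ′
    regroup K {ρ} {x} {d} {ρ′} eq = trans (ring₁ K ρ x) (trans (cong (λ y → + 4 * K + y) eq) (ring₂ K d ρ′))
      where ring₁ : ∀ K ρ x → + 4 * K + ρ + x ≡ + 4 * K + (ρ + x)
            ring₁ = solve-∀
            ring₂ : ∀ K d ρ′ → + 4 * K + (+ 4 * d + ρ′) ≡ + 4 * (K + d) + ρ′
            ring₂ = solve-∀

    offset-shift : ∀ K {d κ′ κ} → C * d + κ′ ≡ κ mod n → C * (K + d) + κ′ ≡ C * K + κ mod n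
    offset-shift K {d} {κ′} {κ} eq = mod-scale eq 1ℤ (ring C K d κ′ κ)
      where ring : ∀ C K d κ′ κ → C * (K + d) + κ′ - (C * K + κ) ≡ 1ℤ * (C * d + κ′ - κ)
            ring = solve-∀

    record BlueRedCase (s : Layer) (ρ : Fin 4) : Set where
      constructor blue-red-case
      field
        d : ℤ
        ρ′ : Fin 4
        block≡ : + toℕ ρ + sign (toℕ ρ) * β s ≡ + 4 * d + + toℕ ρ′
        layer≡ : τ s ρ′ ≡ flip (τ s ρ)
        offset≡ : Negligible (C * d + κ s ρ′ - κ s ρ)

    σ-blue-red : (∀ s ρ → BlueRedCase s ρ) → ∀ p → σ (blue p) ≡ red (σ p)
    σ-blue-red cases = by-block _ at-block
      where
      at-block : ∀ s K (ρ : Fin 4) → σ (blue (vtx s (+ 4 * K + + toℕ ρ))) ≡ red (σ (vtx s (+ 4 * K + + toℕ ρ)))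
      at-block s K ρ = begin
        σ (blue (vtx s (+ 4 * K + + toℕ ρ)))
          ≡⟨ cong σ (move (shift-moves blueStep s) (block-parity K ρ)) ⟩
        σ (vtx s (+ 4 * K + + toℕ ρ + sign (toℕ ρ) * blueStep s))
          ≡⟨ cong (λ c → σ (vtx s (+ 4 * K + + toℕ ρ + sign (toℕ ρ) * c))) (blueStep≡β s) ⟩
        σ (vtx s (+ 4 * K + + toℕ ρ + sign (toℕ ρ) * β s))
          ≡⟨ cong (σ ∘ vtx s) (regroup K {+ toℕ ρ} {sign (toℕ ρ) * β s} {d} {+ toℕ ρ′} block≡) ⟩
        σ (vtx s (+ 4 * (K + d) + + toℕ ρ′))
          ≡⟨ σ-block s (K + d) ρ′ ⟩
        vtx (τ s ρ′) (C * (K + d) + κ s ρ′)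
          ≡⟨ cong (λ s′ → vtx s′ (C * (K + d) + κ s ρ′)) layer≡ ⟩
        vtx (flip (τ s ρ)) (C * (K + d) + κ s ρ′)
          ≡⟨ vtx-cong (offset-shift K {d} {κ s ρ′} {κ s ρ} (negligible⇒mod offset≡)) ⟩
        vtx (flip (τ s ρ)) (C * K + κ s ρ)
          ≡⟨ sym (trans (cong red (σ-block s K ρ)) (red-vtx (τ s ρ) (C * K + κ s ρ))) ⟩
        red (σ (vtx s (+ 4 * K + + toℕ ρ)))  ∎
        where
        open ≡-Reasoning
        open BlueRedCase (cases s ρ)

    record GreenCase (s : Layer) (ρ : Fin 4) : Set where
      constructor green-case
      field
        d : ℤ
        ρ′ : Fin 4
        block≡ : + toℕ ρ + sign (toℕ ρ) * γ s ≡ + 4 * d + + toℕ ρ′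
        layer≡ : τ s ρ′ ≡ τ s ρ
        {π′} : ℤ
        κ-parity : ParitySign (κ s ρ) π′
        offset≡ : Negligible (C * d + κ s ρ′ - (κ s ρ + π′ * γ (τ s ρ)))

    σ-green : (∀ s ρ → GreenCase s ρ) → ∀ p → σ (green p) ≡ green (σ p)
    σ-green cases = by-block _ at-block
      where
      at-block : ∀ s K (ρ : Fin 4) → σ (green (vtx s (+ 4 * K + + toℕ ρ))) ≡ green (σ (vtx s (+ 4 * K + + toℕ ρ)))
      at-block s K ρ = begin
        σ (green (vtx s (+ 4 * K + + toℕ ρ)))
          ≡⟨ cong σ (move (shift-moves greenStep s) (block-parity K ρ)) ⟩
        σ (vtx s (+ 4 * K + + toℕ ρ + sign (toℕ ρ) * greenStep s))
          ≡⟨ cong (λ c → σ (vtx s (+ 4 * K + + toℕ ρ + sign (toℕ ρ) * c))) (greenStep≡γ s) ⟩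
        σ (vtx s (+ 4 * K + + toℕ ρ + sign (toℕ ρ) * γ s))
          ≡⟨ cong (σ ∘ vtx s) (regroup K {+ toℕ ρ} {sign (toℕ ρ) * γ s} {d} {+ toℕ ρ′} block≡) ⟩
        σ (vtx s (+ 4 * (K + d) + + toℕ ρ′))
          ≡⟨ σ-block s (K + d) ρ′ ⟩
        vtx (τ s ρ′) (C * (K + d) + κ s ρ′)
          ≡⟨ cong (λ s′ → vtx s′ (C * (K + d) + κ s ρ′)) layer≡ ⟩
        vtx (τ s ρ) (C * (K + d) + κ s ρ′)
          ≡⟨ vtx-cong (offset-shift K {d} {κ s ρ′} {κ s ρ + π′ * γ (τ s ρ)} (negligible⇒mod offset≡)) ⟩
        vtx (τ s ρ) (C * K + (κ s ρ + π′ * γ (τ s ρ)))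
          ≡⟨ cong (vtx (τ s ρ)) (sym (ℤ.+-assoc (C * K) (κ s ρ) _)) ⟩
        vtx (τ s ρ) (C * K + κ s ρ + π′ * γ (τ s ρ))
          ≡⟨ cong (λ c → vtx (τ s ρ) (C * K + κ s ρ + π′ * c)) (sym (greenStep≡γ (τ s ρ))) ⟩
        vtx (τ s ρ) (C * K + κ s ρ + π′ * greenStep (τ s ρ))
          ≡⟨ sym (move (shift-moves greenStep (τ s ρ)) CK+κ-parity) ⟩
        green (vtx (τ s ρ) (C * K + κ s ρ))
          ≡⟨ cong green (sym (σ-block s K ρ)) ⟩
        green (σ (vtx s (+ 4 * K + + toℕ ρ)))  ∎
        where
        open ≡-Reasoning
        open GreenCase (cases s ρ)
        CK+κ-parity : ParitySign (C * K + κ s ρ) π′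
        CK+κ-parity = subst (λ x → ParitySign x π′) (ring E K (κ s ρ)) (paritySign-+double κ-parity (+ 2 * E * K))
          where ring : ∀ E K κ → κ + (+ 2 * E * K + + 2 * E * K) ≡ + 4 * E * K + κ
                ring = solve-∀

    record InvolutionCase (s : Layer) (ρ : Fin 4) : Set where
      constructor involution-case
      field
        d : ℤ
        ρ″ : Fin 4
        block≡ : κ s ρ ≡ + 4 * d + + toℕ ρ″
        layer≡ : τ (τ s ρ) ρ″ ≡ s
        offset≡ : Negligible (C * d + κ (τ s ρ) ρ″ - + toℕ ρ)

    σ-involutive : (∀ s ρ → InvolutionCase s ρ) → ∀ p → σ (σ p) ≡ p
    σ-involutive cases = by-block _ at-block
      where
      at-block : ∀ s K (ρ : Fin 4) → σ (σ (vtx s (+ 4 * K + + toℕ ρ))) ≡ vtx s (+ 4 * K + + toℕ ρ)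
      at-block s K ρ = begin
        σ (σ (vtx s (+ 4 * K + + toℕ ρ)))
          ≡⟨ cong σ (σ-block s K ρ) ⟩
        σ (vtx (τ s ρ) (C * K + κ s ρ))
          ≡⟨ cong (σ ∘ vtx (τ s ρ)) (trans (cong (λ x → C * K + x) block≡) (ring E K d (+ toℕ ρ″))) ⟩
        σ (vtx (τ s ρ) (+ 4 * (E * K + d) + + toℕ ρ″))
          ≡⟨ σ-block (τ s ρ) (E * K + d) ρ″ ⟩
        vtx (τ (τ s ρ) ρ″) (C * (E * K + d) + κ (τ s ρ) ρ″)
          ≡⟨ cong (λ s′ → vtx s′ (C * (E * K + d) + κ (τ s ρ) ρ″)) layer≡ ⟩
        vtx s (C * (E * K + d) + κ (τ s ρ) ρ″)
          ≡⟨ vtx-cong (mod-combine {X = C * (E * K + d) + κ (τ s ρ) ρ″} {Y = + 4 * K + + toℕ ρ}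
                                   square (negligible⇒mod {C * d + κ (τ s ρ) ρ″} {+ toℕ ρ} offset≡) K 1ℤ (ring′ E K d (κ (τ s ρ) ρ″) (+ toℕ ρ))) ⟩
        vtx s (+ 4 * K + + toℕ ρ)  ∎
        where
        open ≡-Reasoning
        open InvolutionCase (cases s ρ)
        ring : ∀ E K d ρ″ → + 4 * E * K + (+ 4 * d + ρ″) ≡ + 4 * (E * K + d) + ρ″
        ring = solve-∀
        ring′ : ∀ E K d κ ρ → + 4 * E * (E * K + d) + κ - (+ 4 * K + ρ)
                              ≡ K * (+ 4 * E * E - + 4) + 1ℤ * (+ 4 * E * d + κ - ρ)
        ring′ = solve-∀

    no-offset : ∀ {κ} → Negligible (C * 0ℤ + κ - κ)
    no-offset {κ} = combination 0ℤ 0ℤ (ring C κ (C * E - + 4) (+ 8 * H))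
      where ring : ∀ C κ X Y → C * 0ℤ + κ - κ ≡ 0ℤ * X + 0ℤ * Y
            ring = solve-∀

    A-odd : Oddℤ A
    A-odd = odd (+ 4 * A₁ + 1ℤ) eq refl
      where eq : + 8 * A₁ + + 3 ≡ + 4 * A₁ + 1ℤ + (+ 4 * A₁ + 1ℤ) + 1ℤ
            eq = solve (A₁ ∷ [])

    B-odd : Oddℤ B
    B-odd = odd (+ 2 * H + + 4 * A₁) eq refl
      where eq : + 4 * H + + 8 * A₁ + + 1 ≡ + 2 * H + + 4 * A₁ + (+ 2 * H + + 4 * A₁) + 1ℤ
            eq = solve (H ∷ A₁ ∷ [])

    B-A+4-even : Evenℤ (B - A + + 4)
    B-A+4-even = even (+ 2 * H + 1ℤ) eq refl
      where eq : + 4 * H + + 8 * A₁ + + 1 - (+ 8 * A₁ + + 3) + + 4 ≡ + 2 * H + 1ℤ + (+ 2 * H + 1ℤ)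
            eq = solve (H ∷ A₁ ∷ [])

    A-1-even : Evenℤ (A - 1ℤ)
    A-1-even = even (+ 4 * A₁ + 1ℤ) eq refl
      where eq : + 8 * A₁ + + 3 - 1ℤ ≡ + 4 * A₁ + 1ℤ + (+ 4 * A₁ + 1ℤ)
            eq = solve (A₁ ∷ [])

    -- In the case tables, C, E, A and B are written out in terms of H and A₁ so that the ring solver sees them.
    blue-red-cases : ∀ s ρ → BlueRedCase s ρ
    blue-red-cases outer 0F = blue-red-case 0ℤ 1F refl refl no-offset
    blue-red-cases outer 1F = blue-red-case 0ℤ 0F refl refl no-offset
    blue-red-cases outer 2F = blue-red-case 0ℤ 3F refl refl no-offset
    blue-red-cases outer 3F = blue-red-case 0ℤ 2F refl refl no-offset
    blue-red-cases inner 0F = blue-red-case (H + A₁ + A₁) 1F block refl (combination 1ℤ (A₁ + 1ℤ) offset)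
      where
      block : + 0 + 1ℤ * (+ 4 * H + + 8 * A₁ + + 1) ≡ + 4 * (H + A₁ + A₁) + + 1
      block = solve (H ∷ A₁ ∷ [])
      offset : + 4 * (A₁ + A₁ + 1ℤ) * (H + A₁ + A₁) + (+ 4 * H + + 8 * A₁ + + 1) - 1ℤ
             ≡ 1ℤ * (+ 4 * (A₁ + A₁ + 1ℤ) * (A₁ + A₁ + 1ℤ) - + 4) + (A₁ + 1ℤ) * (+ 8 * H)
      offset = solve (H ∷ A₁ ∷ [])
    blue-red-cases inner 1F = blue-red-case (- (H + A₁ + A₁)) 0F block refl (combination -1ℤ (- (A₁ + 1ℤ)) offset)
      where
      block : + 1 + -1ℤ * (+ 4 * H + + 8 * A₁ + + 1) ≡ + 4 * (- (H + A₁ + A₁)) + + 0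
      block = solve (H ∷ A₁ ∷ [])
      offset : + 4 * (A₁ + A₁ + 1ℤ) * (- (H + A₁ + A₁)) + 1ℤ - (+ 4 * H + + 8 * A₁ + + 1)
             ≡ -1ℤ * (+ 4 * (A₁ + A₁ + 1ℤ) * (A₁ + A₁ + 1ℤ) - + 4) + (- (A₁ + 1ℤ)) * (+ 8 * H)
      offset = solve (H ∷ A₁ ∷ [])
    blue-red-cases inner 2F = blue-red-case (H + A₁ + A₁) 3F block refl (combination 1ℤ A₁ offset)
      where
      block : + 2 + 1ℤ * (+ 4 * H + + 8 * A₁ + + 1) ≡ + 4 * (H + A₁ + A₁) + + 3
      block = solve (H ∷ A₁ ∷ [])
      offset : + 4 * (A₁ + A₁ + 1ℤ) * (H + A₁ + A₁) + ((+ 8 * A₁ + + 3) - 1ℤ) - ((+ 4 * H + + 8 * A₁ + + 1) - (+ 8 * A₁ + + 3) + + 4)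
             ≡ 1ℤ * (+ 4 * (A₁ + A₁ + 1ℤ) * (A₁ + A₁ + 1ℤ) - + 4) + A₁ * (+ 8 * H)
      offset = solve (H ∷ A₁ ∷ [])
    blue-red-cases inner 3F = blue-red-case (- (H + A₁ + A₁)) 2F block refl (combination -1ℤ (- A₁) offset)
      where
      block : + 3 + -1ℤ * (+ 4 * H + + 8 * A₁ + + 1) ≡ + 4 * (- (H + A₁ + A₁)) + + 2
      block = solve (H ∷ A₁ ∷ [])
      offset : + 4 * (A₁ + A₁ + 1ℤ) * (- (H + A₁ + A₁)) + ((+ 4 * H + + 8 * A₁ + + 1) - (+ 8 * A₁ + + 3) + + 4) - ((+ 8 * A₁ + + 3) - 1ℤ)
             ≡ -1ℤ * (+ 4 * (A₁ + A₁ + 1ℤ) * (A₁ + A₁ + 1ℤ) - + 4) + (- A₁) * (+ 8 * H)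
      offset = solve (H ∷ A₁ ∷ [])

    green-cases : ∀ s ρ → GreenCase s ρ
    green-cases outer 0F = green-case -1ℤ 3F refl refl 0-even (combination 0ℤ 0ℤ offset)
      where
      offset : + 4 * (A₁ + A₁ + 1ℤ) * -1ℤ + (+ 8 * A₁ + + 3) - (0ℤ + 1ℤ * -1ℤ)
             ≡ 0ℤ * (+ 4 * (A₁ + A₁ + 1ℤ) * (A₁ + A₁ + 1ℤ) - + 4) + 0ℤ * (+ 8 * H)
      offset = solve (H ∷ A₁ ∷ [])
    green-cases outer 1F = green-case 0ℤ 2F refl refl 0-even (combination 0ℤ 0ℤ offset)
      where
      offset : + 4 * (A₁ + A₁ + 1ℤ) * 0ℤ + (+ 8 * A₁ + + 3) - (0ℤ + 1ℤ * (+ 8 * A₁ + + 3))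
             ≡ 0ℤ * (+ 4 * (A₁ + A₁ + 1ℤ) * (A₁ + A₁ + 1ℤ) - + 4) + 0ℤ * (+ 8 * H)
      offset = solve (H ∷ A₁ ∷ [])
    green-cases outer 2F = green-case 0ℤ 1F refl refl A-odd (combination 0ℤ 0ℤ offset)
      where
      offset : + 4 * (A₁ + A₁ + 1ℤ) * 0ℤ + 0ℤ - ((+ 8 * A₁ + + 3) + -1ℤ * (+ 8 * A₁ + + 3))
             ≡ 0ℤ * (+ 4 * (A₁ + A₁ + 1ℤ) * (A₁ + A₁ + 1ℤ) - + 4) + 0ℤ * (+ 8 * H)
      offset = solve (H ∷ A₁ ∷ [])
    green-cases outer 3F = green-case 1ℤ 0F refl refl A-odd (combination 0ℤ 0ℤ offset)
      where
      offset : + 4 * (A₁ + A₁ + 1ℤ) * 1ℤ + 0ℤ - ((+ 8 * A₁ + + 3) + -1ℤ * -1ℤ)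
             ≡ 0ℤ * (+ 4 * (A₁ + A₁ + 1ℤ) * (A₁ + A₁ + 1ℤ) - + 4) + 0ℤ * (+ 8 * H)
      offset = solve (H ∷ A₁ ∷ [])
    green-cases inner 0F = green-case (A₁ + A₁) 3F block refl 1-odd (combination 1ℤ 0ℤ offset)
      where
      block : + 0 + 1ℤ * (+ 8 * A₁ + + 3) ≡ + 4 * (A₁ + A₁) + + 3
      block = solve (H ∷ A₁ ∷ [])
      offset : + 4 * (A₁ + A₁ + 1ℤ) * (A₁ + A₁) + ((+ 8 * A₁ + + 3) - 1ℤ) - (1ℤ + -1ℤ * -1ℤ)
             ≡ 1ℤ * (+ 4 * (A₁ + A₁ + 1ℤ) * (A₁ + A₁ + 1ℤ) - + 4) + 0ℤ * (+ 8 * H)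
      offset = solve (H ∷ A₁ ∷ [])
    green-cases inner 1F = green-case (- (A₁ + A₁ + 1ℤ)) 2F block refl B-odd (combination -1ℤ 0ℤ offset)
      where
      block : + 1 + -1ℤ * (+ 8 * A₁ + + 3) ≡ + 4 * (- (A₁ + A₁ + 1ℤ)) + + 2
      block = solve (H ∷ A₁ ∷ [])
      offset : + 4 * (A₁ + A₁ + 1ℤ) * (- (A₁ + A₁ + 1ℤ)) + ((+ 4 * H + + 8 * A₁ + + 1) - (+ 8 * A₁ + + 3) + + 4) - ((+ 4 * H + + 8 * A₁ + + 1) + -1ℤ * (+ 8 * A₁ + + 3))
             ≡ -1ℤ * (+ 4 * (A₁ + A₁ + 1ℤ) * (A₁ + A₁ + 1ℤ) - + 4) + 0ℤ * (+ 8 * H)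
      offset = solve (H ∷ A₁ ∷ [])
    green-cases inner 2F = green-case (A₁ + A₁ + 1ℤ) 1F block refl B-A+4-even (combination 1ℤ 0ℤ offset)
      where
      block : + 2 + 1ℤ * (+ 8 * A₁ + + 3) ≡ + 4 * (A₁ + A₁ + 1ℤ) + + 1
      block = solve (H ∷ A₁ ∷ [])
      offset : + 4 * (A₁ + A₁ + 1ℤ) * (A₁ + A₁ + 1ℤ) + (+ 4 * H + + 8 * A₁ + + 1) - (((+ 4 * H + + 8 * A₁ + + 1) - (+ 8 * A₁ + + 3) + + 4) + 1ℤ * (+ 8 * A₁ + + 3))
             ≡ 1ℤ * (+ 4 * (A₁ + A₁ + 1ℤ) * (A₁ + A₁ + 1ℤ) - + 4) + 0ℤ * (+ 8 * H)
      offset = solve (H ∷ A₁ ∷ [])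
    green-cases inner 3F = green-case (- (A₁ + A₁)) 0F block refl A-1-even (combination -1ℤ 0ℤ offset)
      where
      block : + 3 + -1ℤ * (+ 8 * A₁ + + 3) ≡ + 4 * (- (A₁ + A₁)) + + 0
      block = solve (H ∷ A₁ ∷ [])
      offset : + 4 * (A₁ + A₁ + 1ℤ) * (- (A₁ + A₁)) + 1ℤ - (((+ 8 * A₁ + + 3) - 1ℤ) + 1ℤ * -1ℤ)
             ≡ -1ℤ * (+ 4 * (A₁ + A₁ + 1ℤ) * (A₁ + A₁ + 1ℤ) - + 4) + 0ℤ * (+ 8 * H)
      offset = solve (H ∷ A₁ ∷ [])

    involution-cases : ∀ s ρ → InvolutionCase s ρ
    involution-cases outer 0F = involution-case 0ℤ 0F refl refl (combination 0ℤ 0ℤ offset)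
      where
      offset : + 4 * (A₁ + A₁ + 1ℤ) * 0ℤ + 0ℤ - + 0
             ≡ 0ℤ * (+ 4 * (A₁ + A₁ + 1ℤ) * (A₁ + A₁ + 1ℤ) - + 4) + 0ℤ * (+ 8 * H)
      offset = solve (H ∷ A₁ ∷ [])
    involution-cases outer 1F = involution-case 0ℤ 0F refl refl (combination 0ℤ 0ℤ offset)
      where
      offset : + 4 * (A₁ + A₁ + 1ℤ) * 0ℤ + 1ℤ - + 1
             ≡ 0ℤ * (+ 4 * (A₁ + A₁ + 1ℤ) * (A₁ + A₁ + 1ℤ) - + 4) + 0ℤ * (+ 8 * H)
      offset = solve (H ∷ A₁ ∷ [])
    involution-cases outer 2F = involution-case (A₁ + A₁) 3F block refl (combination 1ℤ 0ℤ offset)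
      where
      block : (+ 8 * A₁ + + 3) ≡ + 4 * (A₁ + A₁) + + 3
      block = solve (H ∷ A₁ ∷ [])
      offset : + 4 * (A₁ + A₁ + 1ℤ) * (A₁ + A₁) + ((+ 8 * A₁ + + 3) - 1ℤ) - + 2
             ≡ 1ℤ * (+ 4 * (A₁ + A₁ + 1ℤ) * (A₁ + A₁ + 1ℤ) - + 4) + 0ℤ * (+ 8 * H)
      offset = solve (H ∷ A₁ ∷ [])
    involution-cases outer 3F = involution-case (A₁ + A₁) 3F block refl (combination 1ℤ 0ℤ offset)
      where
      block : (+ 8 * A₁ + + 3) ≡ + 4 * (A₁ + A₁) + + 3
      block = solve (H ∷ A₁ ∷ [])
      offset : + 4 * (A₁ + A₁ + 1ℤ) * (A₁ + A₁) + (+ 8 * A₁ + + 3) - + 3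
             ≡ 1ℤ * (+ 4 * (A₁ + A₁ + 1ℤ) * (A₁ + A₁ + 1ℤ) - + 4) + 0ℤ * (+ 8 * H)
      offset = solve (H ∷ A₁ ∷ [])
    involution-cases inner 0F = involution-case 0ℤ 1F refl refl (combination 0ℤ 0ℤ offset)
      where
      offset : + 4 * (A₁ + A₁ + 1ℤ) * 0ℤ + 0ℤ - + 0
             ≡ 0ℤ * (+ 4 * (A₁ + A₁ + 1ℤ) * (A₁ + A₁ + 1ℤ) - + 4) + 0ℤ * (+ 8 * H)
      offset = solve (H ∷ A₁ ∷ [])
    involution-cases inner 1F = involution-case (H + A₁ + A₁) 1F block refl (combination 1ℤ (A₁ + 1ℤ) offset)
      where
      block : (+ 4 * H + + 8 * A₁ + + 1) ≡ + 4 * (H + A₁ + A₁) + + 1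
      block = solve (H ∷ A₁ ∷ [])
      offset : + 4 * (A₁ + A₁ + 1ℤ) * (H + A₁ + A₁) + (+ 4 * H + + 8 * A₁ + + 1) - + 1
             ≡ 1ℤ * (+ 4 * (A₁ + A₁ + 1ℤ) * (A₁ + A₁ + 1ℤ) - + 4) + (A₁ + 1ℤ) * (+ 8 * H)
      offset = solve (H ∷ A₁ ∷ [])
    involution-cases inner 2F = involution-case H 2F block refl (combination 0ℤ (A₁ + 1ℤ) offset)
      where
      block : ((+ 4 * H + + 8 * A₁ + + 1) - (+ 8 * A₁ + + 3) + + 4) ≡ + 4 * H + + 2
      block = solve (H ∷ A₁ ∷ [])
      offset : + 4 * (A₁ + A₁ + 1ℤ) * H + ((+ 4 * H + + 8 * A₁ + + 1) - (+ 8 * A₁ + + 3) + + 4) - + 2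
             ≡ 0ℤ * (+ 4 * (A₁ + A₁ + 1ℤ) * (A₁ + A₁ + 1ℤ) - + 4) + (A₁ + 1ℤ) * (+ 8 * H)
      offset = solve (H ∷ A₁ ∷ [])
    involution-cases inner 3F = involution-case (A₁ + A₁) 2F block refl (combination 1ℤ 0ℤ offset)
      where
      block : ((+ 8 * A₁ + + 3) - 1ℤ) ≡ + 4 * (A₁ + A₁) + + 2
      block = solve (H ∷ A₁ ∷ [])
      offset : + 4 * (A₁ + A₁ + 1ℤ) * (A₁ + A₁) + (+ 8 * A₁ + + 3) - + 3
             ≡ 1ℤ * (+ 4 * (A₁ + A₁ + 1ℤ) * (A₁ + A₁ + 1ℤ) - + 4) + 0ℤ * (+ 8 * H)
      offset = solve (H ∷ A₁ ∷ [])

    σ-swaps : SwapsBlueRed σ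
    σ-swaps = record
      { involutive = σ-involutive involution-cases
      ; blue-red = σ-blue-red blue-red-cases
      ; green-green = σ-green green-cases
      }

  construction : ConstructionData n a b → Σ (V n → V n) SwapsBlueRed
  construction record { H = H ; A₁ = A₁ ; n≡8H = n≡8H ; a≡8A₁+3 = a≡ ; b≡4H+8A₁+1 = b≡ ; square = square } =
    Construction.σ H A₁ n≡8H a≡ b≡ square , Construction.σ-swaps H A₁ n≡8H a≡ b≡ square

open Arithmetic using (congruences⇒conditions; b-2<n-a-2⇒a+b<n; conditions⇒data)
import Data.Nat.Properties as ℕ
open import Data.Nat using (ℕ; zero; suc; _+_; _*_; _∸_; _^_; _<_; s≤s; z≤n)
open import Data.Nat.DivMod using (_/_)
open import Data.Nat.Divisibility using (_∣_)
open import Data.Integer using (+_)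
open import Data.Product using (Σ; _×_; _,_)
open import Function.Bundles using (_⇔_; mk⇔)

proposition8p4 : (n a b : ℕ) → Params n a b → Feasible n a b → 1 < a
    → V0VaInG n a b
    → (Σ (V n → V n) (λ σ → IsAutomorphism n a b σ × HasOrder2 σ
          × MapsOnto σ (Bc n a b) (Rc n a b) × MapsOnto σ (Rc n a b) (Bc n a b)))
      ⇔ (8 ∣ n × (Σ ℕ λ a₀ → a ≡ 4 * a₀ + 3 × Even a₀
          × CongZ n (+ (4 * (a₀ + 1) ^ 2)) (+ 4))
          × 4 * a < n + 4 × b ≡ n / 2 + a ∸ 2)
proposition8p4 zero a b (_ , () , _) _ _ _
proposition8p4 (suc n′) a b (n-even , 4≤n , a-odd , b-odd , _ , a<b , b<n) (_ , _ , _ , _ , _ , b-2<n-a-2) 1<a v₀vₐ∈G =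
  mk⇔ (λ (σ , σ-swapping) → congruences⇒conditions 1<a a<b a+b<n
                               (Necessity.congruences (swapping-involution⇒swap 2<n a<b b<n σ-swapping)))
      (λ conds → let (σ , σ-swaps) = construction (conditions⇒data conds) in σ , swap⇒swapping-involution σ-swaps)
  where
  open Matchings n′ a b n-even a-odd b-odd
  open Colours (v₀vₐ∈G⇒¬CondA a<b b<n v₀vₐ∈G)
  2<n : 2 < suc n′
  2<n = ℕ.<-≤-trans (s≤s (s≤s (s≤s z≤n))) 4≤n
  a+b<n : a + b < suc n′
  a+b<n = b-2<n-a-2⇒a+b<n (ℕ.<⇒≤ (ℕ.<-trans a<b b<n)) b-2<n-a-2
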